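{- Let $n\ge 2$ and let $(\mathbf{d},\mathbf{r})$ be an arithmetical structure on the cycle $\mathcal{C}_n$. Then \[\mathbf{r}(1)=3n-\sum_{j=1}^n d_j\] and the critical group satisfies $K(\mathcal{C}_n,\mathbf{d},\mathbf{r})\cong\mathbb{Z}/\mathbf{r}(1)\mathbb{Z}$.
   Context: For $n\ge 3$, $\mathcal{C}_n$ is the cycle graph with vertices $1,\dots,n$ and edges $\{i,i+1\}$ (indices mod $n$); $\mathcal{C}_2$ is two vertices joined by two parallel edges (adjacency matrix $\begin{pmatrix}0&2\\2&0\end{pmatrix}$). An arithmetical structure on $\mathcal{C}_n$ is a pair $(\mathbf{d},\mathbf{r})$ of positive integer vectors in $\mathbb{Z}^n$ with $\mathbf{r}$ primitive (gcd of entries $1$) and $(\operatorname{diag}(\mathbf{d})-A)\mathbf{r}=\mathbf{0}$, $A$ the adjacency matrix. The critical group $K(\mathcal{C}_n,\mathbf{d},\mathbf{r})$ is the torsion subgroup of $\mathbb{Z}^n/\operatorname{im}(\operatorname{diag}(\mathbf{d})-A)$. $\mathbf{r}(1)=\#\{i:r_i=1\}$. -}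

module Defs where

open import Data.Nat as ℕ using (ℕ; zero; suc; _≡ᵇ_)
open import Data.Nat.GCD using (gcd)
open import Data.Integer as ℤ using (ℤ; +_; _+_; _*_; _-_)
open import Data.Integer.Divisibility using (_∣_)
open import Data.Fin using (Fin; toℕ)
import Data.Fin as Fin
open import Data.Bool using (Bool; true; false; if_then_else_; _∨_; _∧_)
open import Data.Product using (Σ; _×_; ∃; ∃-syntax)
open import Relation.Binary.PropositionalEquality using (_≡_)

sumℤ : ∀ {n} → (Fin n → ℤ) → ℤ
sumℤ {zero}  f = + 0
sumℤ {suc n} f = f Fin.zero + sumℤ (λ i → f (Fin.suc i))

sumℕ : ∀ {n} → (Fin n → ℕ) → ℕ
sumℕ {zero}  f = 0
sumℕ {suc n} f = f Fin.zero ℕ.+ sumℕ (λ i → f (Fin.suc i))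

gcdAll : ∀ {n} → (Fin n → ℕ) → ℕ
gcdAll {zero}  f = 0
gcdAll {suc n} f = gcd (f Fin.zero) (gcdAll (λ i → f (Fin.suc i)))

-- vertices are 0..n-1 (vertex k+1 of the paper is index k);
-- isNext n i j : j ≡ i + 1 (mod n)
isNext : ℕ → ℕ → ℕ → Bool
isNext n i j = (suc i ≡ᵇ j) ∨ ((suc i ≡ᵇ n) ∧ (j ≡ᵇ 0))

-- For n ≥ 3 this is the 0/1 adjacency matrix of C_n; for n = 2 it gives
-- the matrix [[0,2],[2,0]] (two parallel edges), as in the paper.
adj : (n : ℕ) → Fin n → Fin n → ℤ
adj n i j =
  (if isNext n (toℕ i) (toℕ j) then + 1 else + 0) +
  (if isNext n (toℕ j) (toℕ i) then + 1 else + 0)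

Vecℤ : ℕ → Set
Vecℤ n = Fin n → ℤ

lap : (n : ℕ) → (Fin n → ℕ) → Vecℤ n → Vecℤ n
lap n d x i = (+ d i) * x i - sumℤ (λ j → adj n i j * x j)

IsArithStructure : (n : ℕ) → (d r : Fin n → ℕ) → Set
IsArithStructure n d r =
  (∀ i → 1 ℕ.≤ d i) × (∀ i → 1 ℕ.≤ r i) × (gcdAll r ≡ 1) ×
  (∀ i → lap n d (λ j → + r j) i ≡ + 0)

r1 : ∀ {n} → (Fin n → ℕ) → ℕ
r1 r = sumℕ (λ i → if r i ≡ᵇ 1 then 1 else 0)

InImage : (n : ℕ) → (Fin n → ℕ) → Vecℤ n → Set
InImage n d x = ∃[ z ] (∀ i → x i ≡ lap n d z i)

IsTorsion : (n : ℕ) → (Fin n → ℕ) → Vecℤ n → Set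
IsTorsion n d x = ∃[ k ] (1 ℕ.≤ k × InImage n d (λ i → (+ k) * x i))

_≡[mod_]_ : ℤ → ℕ → ℤ → Set
a ≡[mod m ] b = (+ m) ∣ (a - b)

-- A group isomorphism between the critical group
-- K = torsion subgroup of Z^n / im(diag(d) - A)  (elements: torsion
-- representatives x, modulo im(diag(d)-A)) and Z/mZ (elements: integers mod m).
-- ψ x t is the image of the class of x (t a proof that the class is torsion).
CritGroupIsoZmod : (n : ℕ) → (d : Fin n → ℕ) → (m : ℕ) → Set
CritGroupIsoZmod n d m =
  Σ ((x : Vecℤ n) → IsTorsion n d x → ℤ) λ ψ →
    (∀ x y (tx : IsTorsion n d x) (ty : IsTorsion n d y) →
       InImage n d (λ i → x i - y i) → ψ x tx ≡[mod m ] ψ y ty) ×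
    (∀ x y (tx : IsTorsion n d x) (ty : IsTorsion n d y)
       (txy : IsTorsion n d (λ i → x i + y i)) →
       ψ (λ i → x i + y i) txy ≡[mod m ] (ψ x tx + ψ y ty)) ×
    (∀ x (tx : IsTorsion n d x) → ψ x tx ≡[mod m ] (+ 0) → InImage n d x) ×
    (∀ (a : ℤ) → ∃[ x ] Σ (IsTorsion n d x) λ tx → ψ x tx ≡[mod m ] a)

-- Read the cycle starting from a vertex of minimal label c; the other vertices form a path on
-- which d·r = r⁻ + r⁺.  An interior vertex with d = 1 has label r⁻ + r⁺ > c; deleting it and
-- lowering d at both neighbours gives a shorter cycle with the same data c, the same number of
-- labels equal to c, Σ d lowered by 3 and the same continuant of the interior d's.  Without such
-- a vertex the labels are convex along the path, which forces every label to be c and every d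
-- to be 2.  So c divides all labels, c = 1 by primitivity, r(1) = 3n − Σ d, and the continuant
-- of the interior d's equals r(1).
--
-- For the critical group, send x to the value at the root of the solution of (diag d − A) z = x
-- along the path that starts with z = 0 at the root and its successor.  Torsion elements are
-- orthogonal to r, and for those this value is a multiple of the continuant exactly when x lies
-- in the image; it is additive, and every residue is attained.

module Submission where

open import Defs
open import Data.Nat as ℕ using (ℕ)
open import Data.Fin using (Fin)

module Recurrence where

  open import Data.Nat as ℕ using (ℕ; zero; suc)
  import Data.Nat.Properties as ℕ
  open import Data.Integer using (ℤ; +_; _+_; _*_; _-_)
  import Data.Integer.Properties as ℤ
  open import Data.Integer.Tactic.RingSolver using (solve-∀)
  open import Data.Product using (_×_; _,_)
  open import Relation.Binary.PropositionalEquality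

  -- Solves D k · z k = z (k−1) + z (k+1) + X k for z (k+1).
  step : (ℕ → ℕ) → (ℕ → ℤ) → ℕ → ℤ × ℤ → ℤ × ℤ
  step D X k (u , v) = (v , + D k * v - u - X k)

  run : (ℕ → ℕ) → (ℕ → ℤ) → ℕ → ℕ → ℤ × ℤ → ℤ × ℤ
  run D X a zero    uv = uv
  run D X a (suc ℓ) uv = step D X (suc (a ℕ.+ ℓ)) (run D X a ℓ uv)

  unforced : ℕ → ℤ
  unforced _ = + 0

  Solves : (ℕ → ℕ) → (Z X : ℕ → ℤ) → ℕ → ℕ → Set
  Solves D Z X a ℓ = ∀ j → j ℕ.< ℓ → let k = suc (a ℕ.+ j) in
    X k ≡ + D k * Z k - (Z (suc k) + Z (a ℕ.+ j))

  run-solution : ∀ D Z X a ℓ → Solves D Z X a ℓ →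
    run D X a ℓ (Z a , Z (suc a)) ≡ (Z (a ℕ.+ ℓ) , Z (suc (a ℕ.+ ℓ)))
  run-solution D Z X a zero    sol rewrite ℕ.+-identityʳ a = refl
  run-solution D Z X a (suc ℓ) sol
    rewrite run-solution D Z X a ℓ (λ j j<ℓ → sol j (ℕ.m<n⇒m<1+n j<ℓ)) | ℕ.+-suc a ℓ | sol ℓ ℕ.≤-refl
    = cong (Z k ,_) (solve-back (+ D k) (Z k) (Z (suc k)) (Z (a ℕ.+ ℓ)))
    where
    k : ℕ
    k = suc (a ℕ.+ ℓ)
    solve-back : ∀ d z z⁺ z⁻ → d * z - z⁻ - (d * z - (z⁺ + z⁻)) ≡ z⁺
    solve-back = solve-∀

  run-cong : ∀ D X Y a ℓ uv → (∀ k → X k ≡ Y k) → run D X a ℓ uv ≡ run D Y a ℓ uv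
  run-cong D X Y a zero    uv X≗Y = refl
  run-cong D X Y a (suc ℓ) uv X≗Y rewrite run-cong D X Y a ℓ uv X≗Y | X≗Y (suc (a ℕ.+ ℓ)) = refl

  run-+ : ∀ D X Y a ℓ u v u′ v′ → let (p , q) = run D X a ℓ (u , v); (p′ , q′) = run D Y a ℓ (u′ , v′) in
    run D (λ k → X k + Y k) a ℓ (u + u′ , v + v′) ≡ (p + p′ , q + q′)
  run-+ D X Y a zero    u v u′ v′ = refl
  run-+ D X Y a (suc ℓ) u v u′ v′ rewrite run-+ D X Y a ℓ u v u′ v′
    with run D X a ℓ (u , v) | run D Y a ℓ (u′ , v′)
  ... | (p , q) | (p′ , q′) =
    cong (q + q′ ,_) (distrib (+ D (suc (a ℕ.+ ℓ))) p q (X (suc (a ℕ.+ ℓ))) p′ q′ (Y (suc (a ℕ.+ ℓ))))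
    where
    distrib : ∀ d u v x u′ v′ y → d * (v + v′) - (u + u′) - (x + y) ≡ (d * v - u - x) + (d * v′ - u′ - y)
    distrib = solve-∀

  run-* : ∀ D X a ℓ c u v → let (p , q) = run D X a ℓ (u , v) in
    run D (λ k → c * X k) a ℓ (c * u , c * v) ≡ (c * p , c * q)
  run-* D X a zero    c u v = refl
  run-* D X a (suc ℓ) c u v rewrite run-* D X a ℓ c u v with run D X a ℓ (u , v)
  ... | (p , q) = cong (c * q ,_) (distrib c (+ D (suc (a ℕ.+ ℓ))) p q (X (suc (a ℕ.+ ℓ))))
    where
    distrib : ∀ c d u v x → d * (c * v) - c * u - c * x ≡ c * (d * v - u - x)
    distrib = solve-∀

  run-affine : ∀ D X a ℓ u v →
    let (a₁ , a₂) = run D unforced a ℓ (+ 1 , + 0)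
        (p₁ , p₂) = run D unforced a ℓ (+ 0 , + 1)
        (q₁ , q₂) = run D X a ℓ (+ 0 , + 0)
    in run D X a ℓ (u , v) ≡ (u * a₁ + v * p₁ + q₁ , u * a₂ + v * p₂ + q₂)
  run-affine D X a zero u v = cong₂ _,_ (first u v) (second u v)
    where
    first : ∀ u v → u ≡ u * + 1 + v * + 0 + + 0
    first = solve-∀
    second : ∀ u v → v ≡ u * + 0 + v * + 1 + + 0
    second = solve-∀
  run-affine D X a (suc ℓ) u v rewrite run-affine D X a ℓ u v
    with run D unforced a ℓ (+ 1 , + 0) | run D unforced a ℓ (+ 0 , + 1) | run D X a ℓ (+ 0 , + 0)
  ... | (a₁ , a₂) | (p₁ , p₂) | (q₁ , q₂) =
    cong (u * a₂ + v * p₂ + q₂ ,_) (expand (+ D (suc (a ℕ.+ ℓ))) u v a₁ a₂ p₁ p₂ q₁ q₂ (X (suc (a ℕ.+ ℓ))))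
    where
    expand : ∀ d u v a₁ a₂ p₁ p₂ q₁ q₂ x →
      d * (u * a₂ + v * p₂ + q₂) - (u * a₁ + v * p₁ + q₁) - x
        ≡ u * (d * a₂ - a₁ - + 0) + v * (d * p₂ - p₁ - + 0) + (d * q₂ - q₁ - x)
    expand = solve-∀

  run-zero : ∀ D X a ℓ → (∀ j → j ℕ.< ℓ → X (suc (a ℕ.+ j)) ≡ + 0) → run D X a ℓ (+ 0 , + 0) ≡ (+ 0 , + 0)
  run-zero D X a zero    _  = refl
  run-zero D X a (suc ℓ) X≡0
    rewrite run-zero D X a ℓ (λ j j<ℓ → X≡0 j (ℕ.m<n⇒m<1+n j<ℓ)) | X≡0 ℓ ℕ.≤-refl
          | ℤ.*-zeroʳ (+ D (suc (a ℕ.+ ℓ))) = refl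

  sumFrom : (ℕ → ℤ) → ℕ → ℕ → ℤ
  sumFrom f a zero    = + 0
  sumFrom f a (suc ℓ) = sumFrom f a ℓ + f (suc (a ℕ.+ ℓ))

  sumFrom-zero : ∀ f a ℓ → (∀ j → j ℕ.< ℓ → f (suc (a ℕ.+ j)) ≡ + 0) → sumFrom f a ℓ ≡ + 0
  sumFrom-zero f a zero    _ = refl
  sumFrom-zero f a (suc ℓ) f≡0
    rewrite sumFrom-zero f a ℓ (λ j j<ℓ → f≡0 j (ℕ.m<n⇒m<1+n j<ℓ)) | f≡0 ℓ ℕ.≤-refl = refl

  sumFrom-* : ∀ (R X : ℕ → ℤ) c a ℓ → sumFrom (λ k → R k * (c * X k)) a ℓ ≡ c * sumFrom (λ k → R k * X k) a ℓ
  sumFrom-* R X c a zero    = sym (ℤ.*-zeroʳ c)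
  sumFrom-* R X c a (suc ℓ) rewrite sumFrom-* R X c a ℓ =
    distrib (sumFrom (λ k → R k * X k) a ℓ) (R (suc (a ℕ.+ ℓ))) (X (suc (a ℕ.+ ℓ))) c
    where
    distrib : ∀ s r x c → c * s + r * (c * x) ≡ c * (s + r * x)
    distrib = solve-∀

  wronskian : (ℕ → ℕ) → (ℕ → ℤ) → ℕ → ℤ
  wronskian R Z k = + R (suc k) * Z k - + R k * Z (suc k)

  green-identity : ∀ D R Z X a ℓ → Solves D (λ k → + R k) unforced a ℓ → Solves D Z X a ℓ →
    sumFrom (λ k → + R k * X k) a ℓ ≡ wronskian R Z (a ℕ.+ ℓ) - wronskian R Z a
  green-identity D R Z X a zero _ _ rewrite ℕ.+-identityʳ a = sym (ℤ.+-inverseʳ (wronskian R Z a))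
  green-identity D R Z X a (suc ℓ) solR solZ
    rewrite green-identity D R Z X a ℓ (λ j j<ℓ → solR j (ℕ.m<n⇒m<1+n j<ℓ))
                (λ j j<ℓ → solZ j (ℕ.m<n⇒m<1+n j<ℓ)) | ℕ.+-suc a ℓ | solZ ℓ ℕ.≤-refl
    = begin
      (+ R k * Z k⁻ - + R k⁻ * Z k - W₀) + + R k * (+ D k * Z k - (Z k⁺ + Z k⁻))
        ≡⟨ telescope (+ D k) (+ R k) (+ R k⁻) (+ R k⁺) (Z k) (Z k⁻) (Z k⁺) W₀ ⟩
      (+ R k⁺ * Z k - + R k * Z k⁺ - W₀) + Z k * (+ D k * + R k - (+ R k⁺ + + R k⁻))
        ≡⟨ cong (λ w → (+ R k⁺ * Z k - + R k * Z k⁺ - W₀) + Z k * w) (sym (solR ℓ ℕ.≤-refl)) ⟩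
      (+ R k⁺ * Z k - + R k * Z k⁺ - W₀) + Z k * + 0
        ≡⟨ trans (cong (λ w → W₁ + w) (ℤ.*-zeroʳ (Z k))) (ℤ.+-identityʳ W₁) ⟩
      (+ R k⁺ * Z k - + R k * Z k⁺ - W₀) ∎
    where
    open ≡-Reasoning
    k⁻ k k⁺ : ℕ
    k⁻ = a ℕ.+ ℓ
    k = suc k⁻
    k⁺ = suc k
    W₀ W₁ : ℤ
    W₀ = wronskian R Z a
    W₁ = + R k⁺ * Z k - + R k * Z k⁺ - W₀
    telescope : ∀ d r r⁻ r⁺ z z⁻ z⁺ w → (r * z⁻ - r⁻ * z - w) + r * (d * z - (z⁺ + z⁻))
          ≡ (r⁺ * z - r * z⁺ - w) + z * (d * r - (r⁺ + r⁻))
    telescope = solve-∀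

module BalancedPaths where

  open import Data.Nat as ℕ using (ℕ; zero; suc; _+_; _*_; _∸_; _≤_; z≤n; s≤s; _≡ᵇ_; _≟_)
  import Data.Nat.Properties as ℕ
  open import Data.Nat.Divisibility using (_∣_; ∣-refl; ∣m∣n⇒∣m+n)
  open import Data.Nat.Tactic.RingSolver using (solve-∀)
  open import Data.Integer as ℤ using (ℤ)
  open import Data.Integer.Tactic.RingSolver renaming (solve-∀ to solveℤ-∀)
  open import Data.Product using (_×_; _,_; proj₁; proj₂; ∃-syntax)
  open import Data.List using (List; []; _∷_; _++_; _∷ʳ_; length; map; initLast; _∷ʳ′_)
  import Data.List.Properties as List
  open import Data.List.Relation.Unary.All as All using (All; []; _∷_)
  import Data.List.Relation.Unary.All.Properties as All
  open import Data.List.Relation.Unary.Any as Any using (Any)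
  open import Data.List.Membership.Propositional using (find)
  open import Data.List.Membership.Propositional.Properties using (∈-∃++)
  open import Data.Bool using (true; if_then_else_)
  open import Data.Unit using (⊤; tt)
  open import Data.Empty using (⊥-elim)
  open import Function using (_∘_)
  open import Relation.Nullary using (¬_; yes; no)
  open import Relation.Nullary.Decidable using (dec-true; dec-false)
  open import Relation.Binary.PropositionalEquality

  -- A node carries its entry d of diag(d) and its label r.
  Node : Set
  Node = ℕ × ℕ

  firstLabel : List Node → ℕ → ℕ
  firstLabel []            c = c
  firstLabel ((d , r) ∷ _) c = r

  lastLabel : ℕ → List Node → ℕ
  lastLabel a []             = a
  lastLabel a ((d , r) ∷ xs) = lastLabel r xs

  -- A path between two outer vertices labelled a and c on which d·r = r⁻ + r⁺ at every node.
  Balanced : ℕ → List Node → ℕ → Set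
  Balanced a []             c = ⊤
  Balanced a ((d , r) ∷ xs) c = (d * r ≡ a + firstLabel xs c) × Balanced r xs c

  Admissible : ℕ → Node → Set
  Admissible c (d , r) = 1 ≤ d × c ≤ r

  lowerDeg : Node → Node
  lowerDeg (d , r) = (d ∸ 1 , r)

  lowerLast : List Node → List Node
  lowerLast []           = []
  lowerLast (x ∷ [])     = lowerDeg x ∷ []
  lowerLast (x ∷ y ∷ ys) = x ∷ lowerLast (y ∷ ys)

  lowerFirst : List Node → List Node
  lowerFirst []       = []
  lowerFirst (x ∷ xs) = lowerDeg x ∷ xs

  ifEmpty : List Node → ℕ
  ifEmpty []      = 1
  ifEmpty (_ ∷ _) = 0

  count : ℕ → List Node → ℕ
  count c []             = 0
  count c ((d , r) ∷ xs) = (if r ≡ᵇ c then 1 else 0) + count c xs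

  degSum : List Node → ℕ
  degSum []             = 0
  degSum ((d , r) ∷ xs) = d + degSum xs

  degrees : List Node → List ℕ
  degrees = map proj₁

  LabelsDivisibleBy : ℕ → List Node → Set
  LabelsDivisibleBy c = All ((c ∣_) ∘ proj₂)

  continue : List ℕ → ℤ × ℤ → ℤ × ℤ
  continue []       uv      = uv
  continue (d ∷ ds) (u , v) = continue ds (v , ℤ.+ d ℤ.* v ℤ.- u)

  continuant : List ℕ → ℤ
  continuant ds = proj₂ (continue ds (ℤ.+ 0 , ℤ.+ 1))

  continue-++ : ∀ xs ys uv → continue (xs ++ ys) uv ≡ continue ys (continue xs uv)
  continue-++ []       ys uv      = refl
  continue-++ (d ∷ xs) ys (u , v) = continue-++ xs ys _

  ≡ᵇ-refl : ∀ c → (c ≡ᵇ c) ≡ true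
  ≡ᵇ-refl c = dec-true (c ≟ c) refl

  -- For a cycle of ℓ + 1 vertices: the root (d₀ , c) followed by the path L.
  CycleFacts : ℕ → ℕ → ℕ → List Node → Set
  CycleFacts ℓ c d₀ L =
    LabelsDivisibleBy c L × (count c L + 1 + d₀ + degSum L ≡ 3 * suc ℓ) ×
    (continuant (degrees L) ≡ ℤ.+ suc (count c L))

  firstLabel-++ : ∀ P ys c → firstLabel (P ++ ys) c ≡ firstLabel P (firstLabel ys c)
  firstLabel-++ []            ys c = refl
  firstLabel-++ ((d , r) ∷ P) ys c = refl

  lastLabel-++ : ∀ a P ys → lastLabel a (P ++ ys) ≡ lastLabel (lastLabel a P) ys
  lastLabel-++ a []            ys = refl
  lastLabel-++ a ((d , r) ∷ P) ys = lastLabel-++ r P ys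

  Balanced-++⁻ : ∀ a P ys c → Balanced a (P ++ ys) c →
    Balanced a P (firstLabel ys c) × Balanced (lastLabel a P) ys c
  Balanced-++⁻ a []            ys c bal       = tt , bal
  Balanced-++⁻ a ((d , r) ∷ P) ys c (eq , bal) =
    (trans eq (cong (a +_) (firstLabel-++ P ys c)) , proj₁ rest) , proj₂ rest
    where
    rest : Balanced r P (firstLabel ys c) × Balanced (lastLabel r P) ys c
    rest = Balanced-++⁻ r P ys c bal

  Balanced-++⁺ : ∀ a P ys c → Balanced a P (firstLabel ys c) → Balanced (lastLabel a P) ys c →
    Balanced a (P ++ ys) c
  Balanced-++⁺ a []            ys c _           bal = bal
  Balanced-++⁺ a ((d , r) ∷ P) ys c (eq , balP) bal =
    trans eq (cong (a +_) (sym (firstLabel-++ P ys c))) , Balanced-++⁺ r P ys c balP bal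

  firstLabel-lowerLast : ∀ P c → firstLabel (lowerLast P) c ≡ firstLabel P c
  firstLabel-lowerLast []                c = refl
  firstLabel-lowerLast ((d , r) ∷ [])    c = refl
  firstLabel-lowerLast ((d , r) ∷ y ∷ P) c = refl

  lastLabel-lowerLast : ∀ a P → lastLabel a (lowerLast P) ≡ lastLabel a P
  lastLabel-lowerLast a []                = refl
  lastLabel-lowerLast a ((d , r) ∷ [])    = refl
  lastLabel-lowerLast a ((d , r) ∷ y ∷ P) = lastLabel-lowerLast r (y ∷ P)

  firstLabel-lowerFirst : ∀ S c → firstLabel (lowerFirst S) c ≡ firstLabel S c
  firstLabel-lowerFirst []            c = refl
  firstLabel-lowerFirst ((d , r) ∷ S) c = refl

  lastLabel-lowerFirst : ∀ a S → lastLabel a (lowerFirst S) ≡ lastLabel a S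
  lastLabel-lowerFirst a []            = refl
  lastLabel-lowerFirst a ((d , r) ∷ S) = refl

  lowerLast-∷ʳ : ∀ P x → lowerLast (P ∷ʳ x) ≡ P ∷ʳ lowerDeg x
  lowerLast-∷ʳ []          x = refl
  lowerLast-∷ʳ (y ∷ [])    x = refl
  lowerLast-∷ʳ (y ∷ w ∷ P) x = cong (y ∷_) (lowerLast-∷ʳ (w ∷ P) x)

  length-lowerLast : ∀ P → length (lowerLast P) ≡ length P
  length-lowerLast []           = refl
  length-lowerLast (x ∷ [])     = refl
  length-lowerLast (x ∷ y ∷ ys) = cong suc (length-lowerLast (y ∷ ys))

  length-lowerFirst : ∀ S → length (lowerFirst S) ≡ length S
  length-lowerFirst []      = refl
  length-lowerFirst (x ∷ S) = refl

  All-lowerLast⁻ : ∀ (Q : ℕ → Set) P → All (Q ∘ proj₂) (lowerLast P) → All (Q ∘ proj₂) P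
  All-lowerLast⁻ Q []                q        = q
  All-lowerLast⁻ Q ((d , r) ∷ [])    (q ∷ []) = q ∷ []
  All-lowerLast⁻ Q ((d , r) ∷ y ∷ P) (q ∷ qs) = q ∷ All-lowerLast⁻ Q (y ∷ P) qs

  All-lowerFirst⁻ : ∀ (Q : ℕ → Set) S → All (Q ∘ proj₂) (lowerFirst S) → All (Q ∘ proj₂) S
  All-lowerFirst⁻ Q []            q        = q
  All-lowerFirst⁻ Q ((d , r) ∷ S) (q ∷ qs) = q ∷ qs

  count-lowerLast : ∀ c P → count c (lowerLast P) ≡ count c P
  count-lowerLast c []                = refl
  count-lowerLast c ((d , r) ∷ [])    = refl
  count-lowerLast c ((d , r) ∷ y ∷ P) = cong (_ +_) (count-lowerLast c (y ∷ P))

  count-lowerFirst : ∀ c S → count c (lowerFirst S) ≡ count c S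
  count-lowerFirst c []            = refl
  count-lowerFirst c ((d , r) ∷ S) = refl

  count-++ : ∀ c P ys → count c (P ++ ys) ≡ count c P + count c ys
  count-++ c []            ys = refl
  count-++ c ((d , r) ∷ P) ys rewrite count-++ c P ys = sym (ℕ.+-assoc _ (count c P) (count c ys))

  degSum-++ : ∀ P ys → degSum (P ++ ys) ≡ degSum P + degSum ys
  degSum-++ []            ys = refl
  degSum-++ ((d , r) ∷ P) ys rewrite degSum-++ P ys = sym (ℕ.+-assoc d (degSum P) (degSum ys))

  degSum-lowerLast : ∀ c P → All (Admissible c) P → degSum (lowerLast P) + 1 ≡ degSum P + ifEmpty P
  degSum-lowerLast c []                    _                = refl
  degSum-lowerLast c ((zero , r) ∷ [])    ((() , _) ∷ _)
  degSum-lowerLast c ((suc d , r) ∷ [])   _                = trans (ℕ.+-comm (d + 0) 1) (sym (ℕ.+-identityʳ _))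
  degSum-lowerLast c ((d , r) ∷ y ∷ P) (_ ∷ adm) =
    trans (ℕ.+-assoc d _ 1) (trans (cong (d +_) (degSum-lowerLast c (y ∷ P) adm)) (sym (ℕ.+-assoc d _ 0)))

  degSum-lowerFirst : ∀ c S → All (Admissible c) S → degSum (lowerFirst S) + 1 ≡ degSum S + ifEmpty S
  degSum-lowerFirst c []                _              = refl
  degSum-lowerFirst c ((zero , r) ∷ S)  ((() , _) ∷ _)
  degSum-lowerFirst c ((suc d , r) ∷ S) _ = trans (ℕ.+-comm (d + degSum S) 1) (sym (ℕ.+-identityʳ _))

  lastLabel-≥ : ∀ c x P → c ≤ x → All (Admissible c) P → c ≤ lastLabel x P
  lastLabel-≥ c x []            c≤x _                = c≤x
  lastLabel-≥ c x ((d , r) ∷ P) c≤x ((_ , c≤r) ∷ adm) = lastLabel-≥ c r P c≤r adm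

  firstLabel-≥ : ∀ c S → All (Admissible c) S → c ≤ firstLabel S c
  firstLabel-≥ c []            _               = ℕ.≤-refl
  firstLabel-≥ c ((d , r) ∷ S) ((_ , c≤r) ∷ _) = c≤r

  lastLabel-∣ : ∀ c x P → c ∣ x → LabelsDivisibleBy c P → c ∣ lastLabel x P
  lastLabel-∣ c x []            c∣x _            = c∣x
  lastLabel-∣ c x ((d , r) ∷ P) c∣x (c∣r ∷ c∣P) = lastLabel-∣ c r P c∣r c∣P

  firstLabel-∣ : ∀ c S → LabelsDivisibleBy c S → c ∣ firstLabel S c
  firstLabel-∣ c []            _         = ∣-refl
  firstLabel-∣ c ((d , r) ∷ S) (c∣r ∷ _) = c∣r

  lower-balance : ∀ d r k → d * r ≡ r + k → (d ∸ 1) * r ≡ k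
  lower-balance zero    r k eq = sym (ℕ.m+n≡0⇒n≡0 r (sym eq))
  lower-balance (suc d) r k eq = ℕ.+-cancelˡ-≡ r _ _ eq

  lower-positive : ∀ d r k → d * r ≡ r + k → 1 ≤ k → 1 ≤ d ∸ 1
  lower-positive d r k eq 1≤k = ℕ.n≢0⇒n>0 λ d∸1≡0 →
    ℕ.<⇒≢ 1≤k (sym (trans (sym (lower-balance d r k eq)) (cong (_* r) d∸1≡0)))

  private
    swap-middle : ∀ x r b → x + (r + b) ≡ r + (x + b)
    swap-middle = solve-∀

    swap-front : ∀ a r h → r + a + h ≡ r + (a + h)
    swap-front = solve-∀

  Balanced-lowerLast : ∀ x P b → Balanced x P (lastLabel x P + b) → Balanced x (lowerLast P) b
  Balanced-lowerLast x []                         b _         = tt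
  Balanced-lowerLast x ((d , r) ∷ [])             b (eq , tt) =
    lower-balance d r (x + b) (trans eq (swap-middle x r b)) , tt
  Balanced-lowerLast x ((d , r) ∷ (d′ , r′) ∷ P) b (eq , bal) =
    trans eq (cong (x +_) (sym (firstLabel-lowerLast ((d′ , r′) ∷ P) b))) ,
    Balanced-lowerLast r ((d′ , r′) ∷ P) b bal

  Admissible-lowerLast : ∀ c x P b → 1 ≤ b → All (Admissible c) P → Balanced x P (lastLabel x P + b) →
    All (Admissible c) (lowerLast P)
  Admissible-lowerLast c x []                         b 1≤b adm                 _         = []
  Admissible-lowerLast c x ((d , r) ∷ [])             b 1≤b ((_ , c≤r) ∷ [])   (eq , tt) =
    (lower-positive d r (x + b) (trans eq (swap-middle x r b)) (ℕ.≤-trans 1≤b (ℕ.m≤n+m b x)) , c≤r) ∷ []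
  Admissible-lowerLast c x ((d , r) ∷ (d′ , r′) ∷ P) b 1≤b (a ∷ adm)           (eq , bal) =
    a ∷ Admissible-lowerLast c r ((d′ , r′) ∷ P) b 1≤b adm bal

  Balanced-lowerFirst : ∀ a S c → Balanced (a + firstLabel S c) S c → Balanced a (lowerFirst S) c
  Balanced-lowerFirst a []            c _          = tt
  Balanced-lowerFirst a ((d , r) ∷ S) c (eq , bal) =
    lower-balance d r (a + firstLabel S c)
      (trans eq (trans (cong (_+ firstLabel S c) (ℕ.+-comm a r)) (swap-front a r (firstLabel S c)))) , bal

  Admissible-lowerFirst : ∀ c a S → 1 ≤ a → All (Admissible c) S → Balanced (a + firstLabel S c) S c →
    All (Admissible c) (lowerFirst S)
  Admissible-lowerFirst c a []            1≤a adm                 _          = []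
  Admissible-lowerFirst c a ((d , r) ∷ S) 1≤a ((_ , c≤r) ∷ adm)   (eq , bal) =
    (lower-positive d r (a + firstLabel S c)
      (trans eq (trans (cong (_+ firstLabel S c) (ℕ.+-comm a r)) (swap-front a r (firstLabel S c))))
      (ℕ.≤-trans 1≤a (ℕ.m≤m+n a _)) , c≤r) ∷ adm

  firstLabel-shift : ∀ c P b → firstLabel P (lastLabel c P + b) ≡ ifEmpty P * c + firstLabel P b
  firstLabel-shift c []            b = cong (_+ b) (sym (ℕ.*-identityˡ c))
  firstLabel-shift c ((d , r) ∷ P) b = refl

  lastLabel-shift : ∀ c a S → lastLabel (a + firstLabel S c) S ≡ ifEmpty S * c + lastLabel a S
  lastLabel-shift c a []            = trans (ℕ.+-comm a c) (cong (_+ a) (sym (ℕ.*-identityˡ c)))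
  lastLabel-shift c a ((d , r) ∷ S) = refl

  continue-a1b : ∀ a b ds uv → 1 ≤ a → 1 ≤ b →
    continue (a ∷ 1 ∷ b ∷ ds) uv ≡ continue ((a ∸ 1) ∷ (b ∸ 1) ∷ ds) uv
  continue-a1b (suc a) (suc b) ds (u , v) _ _ =
    cong (continue ds) (cong₂ _,_ (eliminate₁ (ℤ.+ a) u v) (eliminate₂ (ℤ.+ a) (ℤ.+ b) u v))
    where
    eliminate₁ : ∀ a u v → ℤ.+ 1 ℤ.* ((ℤ.+ 1 ℤ.+ a) ℤ.* v ℤ.- u) ℤ.- v ≡ a ℤ.* v ℤ.- u
    eliminate₁ = solveℤ-∀
    eliminate₂ : ∀ a b u v →
      (ℤ.+ 1 ℤ.+ b) ℤ.* (ℤ.+ 1 ℤ.* ((ℤ.+ 1 ℤ.+ a) ℤ.* v ℤ.- u) ℤ.- v) ℤ.- ((ℤ.+ 1 ℤ.+ a) ℤ.* v ℤ.- u)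
        ≡ b ℤ.* (a ℤ.* v ℤ.- u) ℤ.- v
    eliminate₂ = solveℤ-∀

  continue-1b : ∀ b ds → 1 ≤ b →
    continue (1 ∷ b ∷ ds) (ℤ.+ 0 , ℤ.+ 1) ≡ continue ((b ∸ 1) ∷ ds) (ℤ.+ 0 , ℤ.+ 1)
  continue-1b (suc b) ds _ = cong (continue ds) (cong (ℤ.+ 1 ,_) (eliminate (ℤ.+ b)))
    where
    eliminate : ∀ b → (ℤ.+ 1 ℤ.+ b) ℤ.* ℤ.+ 1 ℤ.- ℤ.+ 1 ≡ b ℤ.* ℤ.+ 1 ℤ.- ℤ.+ 0
    eliminate = solveℤ-∀

  continue-a1 : ∀ a uv → 1 ≤ a → proj₂ (continue (a ∷ 1 ∷ []) uv) ≡ proj₂ (continue ((a ∸ 1) ∷ []) uv)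
  continue-a1 (suc a) (u , v) _ = eliminate (ℤ.+ a) u v
    where
    eliminate : ∀ a u v → ℤ.+ 1 ℤ.* ((ℤ.+ 1 ℤ.+ a) ℤ.* v ℤ.- u) ℤ.- v ≡ a ℤ.* v ℤ.- u
    eliminate = solveℤ-∀

  degrees-∷ʳ-++ : ∀ P x ys → degrees ((P ∷ʳ x) ++ ys) ≡ degrees P ++ proj₁ x ∷ degrees ys
  degrees-∷ʳ-++ P x ys rewrite List.++-assoc P (x ∷ []) ys = List.map-++ proj₁ P (x ∷ ys)

  continuant-contract : ∀ c P r S → All (Admissible c) P → All (Admissible c) S →
    continuant (degrees (P ++ (1 , r) ∷ S)) ≡ continuant (degrees (lowerLast P ++ lowerFirst S))
  continuant-contract c P r S admP admS with initLast P | S | admS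
  ... | []          | []           | _ = refl
  ... | []          | (b , _) ∷ S′ | (1≤b , _) ∷ _ = cong proj₂ (continue-1b b (degrees S′) 1≤b)
  ... | P₀ ∷ʳ′ (a , ra) | S′ | admS′ with proj₂ (All.∷ʳ⁻ admP)
  ...   | 1≤a , _ rewrite lowerLast-∷ʳ P₀ (a , ra) | degrees-∷ʳ-++ P₀ (a , ra) ((1 , r) ∷ S′)
                        | degrees-∷ʳ-++ P₀ (a ∸ 1 , ra) (lowerFirst S′)
                        | continue-++ (degrees P₀) (a ∷ 1 ∷ degrees S′) (ℤ.+ 0 , ℤ.+ 1)
                        | continue-++ (degrees P₀) ((a ∸ 1) ∷ degrees (lowerFirst S′)) (ℤ.+ 0 , ℤ.+ 1)
    = middle S′ admS′
    where
    uv : ℤ × ℤ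
    uv = continue (degrees P₀) (ℤ.+ 0 , ℤ.+ 1)
    middle : ∀ S′ → All (Admissible c) S′ →
      proj₂ (continue (a ∷ 1 ∷ degrees S′) uv) ≡ proj₂ (continue ((a ∸ 1) ∷ degrees (lowerFirst S′)) uv)
    middle []            _                = continue-a1 a uv 1≤a
    middle ((b , _) ∷ S′) ((1≤b , _) ∷ _) = cong proj₂ (continue-a1b a b (degrees S′) uv 1≤a 1≤b)

  *-split : ∀ d e c h .{{_ : ℕ.NonZero c}} → d * c ≡ e * c + h → ∃[ d′ ] (d′ + e ≡ d) × (d′ * c ≡ h)
  *-split d e c h eq = d ∸ e , ℕ.m∸n+n≡m e≤d , (begin
    (d ∸ e) * c     ≡⟨ ℕ.*-distribʳ-∸ c d e ⟩
    d * c ∸ e * c   ≡⟨ cong (_∸ e * c) eq ⟩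
    e * c + h ∸ e * c ≡⟨ ℕ.m+n∸m≡n (e * c) h ⟩
    h               ∎)
    where
    open ≡-Reasoning
    e≤d : e ≤ d
    e≤d = ℕ.*-cancelʳ-≤ e d c (ℕ.≤-trans (ℕ.m≤m+n (e * c) h) (ℕ.≤-reflexive (sym eq)))

  module Contraction (c : ℕ) (c≥1 : 1 ≤ c) (P : List Node) (r : ℕ) (S : List Node)
    (adm : All (Admissible c) (P ++ (1 , r) ∷ S)) (bal : Balanced c (P ++ (1 , r) ∷ S) c) where

    L L′ : List Node
    L  = P ++ (1 , r) ∷ S
    L′ = lowerLast P ++ lowerFirst S

    a b : ℕ
    a = lastLabel c P
    b = firstLabel S c

    admP : All (Admissible c) P
    admP = All.++⁻ˡ P adm

    admS : All (Admissible c) S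
    admS = All.tail (All.++⁻ʳ P adm)

    balSplit : Balanced c P r × (1 * r ≡ a + b) × Balanced r S c
    balSplit = Balanced-++⁻ c P ((1 , r) ∷ S) c bal

    r≡a+b : r ≡ a + b
    r≡a+b = trans (sym (ℕ.*-identityˡ r)) (proj₁ (proj₂ balSplit))

    balP : Balanced c P (a + b)
    balP = subst (Balanced c P) r≡a+b (proj₁ balSplit)

    balS : Balanced (a + b) S c
    balS = subst (λ x → Balanced x S c) r≡a+b (proj₂ (proj₂ balSplit))

    c≤a : c ≤ a
    c≤a = lastLabel-≥ c c P ℕ.≤-refl admP

    c≤b : c ≤ b
    c≤b = firstLabel-≥ c S admS

    balanced : Balanced c L′ c
    balanced = Balanced-++⁺ c (lowerLast P) (lowerFirst S) c
      (subst (Balanced c (lowerLast P)) (sym (firstLabel-lowerFirst S c)) (Balanced-lowerLast c P b balP))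
      (subst (λ x → Balanced x (lowerFirst S) c) (sym (lastLabel-lowerLast c P)) (Balanced-lowerFirst a S c balS))

    admissible : All (Admissible c) L′
    admissible = All.++⁺ (Admissible-lowerLast c c P b (ℕ.≤-trans c≥1 c≤b) admP balP)
                         (Admissible-lowerFirst c a S (ℕ.≤-trans c≥1 c≤a) admS balS)

    length-contract : suc (length L′) ≡ length L
    length-contract = begin
      suc (length (lowerLast P ++ lowerFirst S))       ≡⟨ cong suc (List.length-++ (lowerLast P)) ⟩
      suc (length (lowerLast P) + length (lowerFirst S)) ≡⟨ cong suc (cong₂ _+_ (length-lowerLast P) (length-lowerFirst S)) ⟩
      suc (length P + length S)                        ≡⟨ sym (ℕ.+-suc (length P) (length S)) ⟩
      length P + length ((1 , r) ∷ S)                  ≡⟨ sym (List.length-++ P) ⟩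
      length L                                         ∎
      where open ≡-Reasoning

    -- A contracted neighbour that is the root lowers d₀ instead.
    removed : ℕ
    removed = ifEmpty P + ifEmpty S

    root : ∀ d₀ → d₀ * c ≡ firstLabel L c + lastLabel c L →
      ∃[ d₀′ ] (d₀′ + removed ≡ d₀) × (d₀′ * c ≡ firstLabel L′ c + lastLabel c L′)
    root d₀ eq = *-split d₀ removed c _ {{ℕ.>-nonZero c≥1}} (begin
      d₀ * c                                                   ≡⟨ eq ⟩
      firstLabel L c + lastLabel c L                           ≡⟨ cong₂ _+_ first last ⟩
      (ifEmpty P * c + firstLabel P b) + (ifEmpty S * c + lastLabel a S) ≡⟨ regroup (ifEmpty P) (ifEmpty S) c _ _ ⟩
      removed * c + (firstLabel P b + lastLabel a S)           ≡⟨ cong (removed * c +_) (sym (cong₂ _+_ first′ last′)) ⟩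
      removed * c + (firstLabel L′ c + lastLabel c L′)         ∎)
      where
      open ≡-Reasoning
      regroup : ∀ i j c h t → (i * c + h) + (j * c + t) ≡ (i + j) * c + (h + t)
      regroup = solve-∀
      first : firstLabel L c ≡ ifEmpty P * c + firstLabel P b
      first = trans (firstLabel-++ P ((1 , r) ∷ S) c) (trans (cong (firstLabel P) r≡a+b) (firstLabel-shift c P b))
      last : lastLabel c L ≡ ifEmpty S * c + lastLabel a S
      last = trans (lastLabel-++ c P ((1 , r) ∷ S)) (trans (cong (λ x → lastLabel x S) r≡a+b) (lastLabel-shift c a S))
      first′ : firstLabel L′ c ≡ firstLabel P b
      first′ = trans (firstLabel-++ (lowerLast P) (lowerFirst S) c)
                 (trans (firstLabel-lowerLast P _) (cong (firstLabel P) (firstLabel-lowerFirst S c)))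
      last′ : lastLabel c L′ ≡ lastLabel a S
      last′ = trans (lastLabel-++ c (lowerLast P) (lowerFirst S))
                (trans (cong (λ x → lastLabel x (lowerFirst S)) (lastLabel-lowerLast c P)) (lastLabel-lowerFirst a S))

    r≢c : ¬ r ≡ c
    r≢c = ℕ.>⇒≢ (ℕ.≤-trans (ℕ.≤-reflexive (ℕ.+-comm 1 c))
            (ℕ.≤-trans (ℕ.+-mono-≤ c≤a (ℕ.≤-trans c≥1 c≤b)) (ℕ.≤-reflexive (sym r≡a+b))))

    count-contract : count c L ≡ count c L′
    count-contract
      rewrite count-++ c P ((1 , r) ∷ S) | count-++ c (lowerLast P) (lowerFirst S)
            | dec-false (r ≟ c) r≢c | count-lowerLast c P | count-lowerFirst c S = refl

    degSum-contract : degSum L + removed ≡ degSum L′ + 3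
    degSum-contract
      rewrite degSum-++ P ((1 , r) ∷ S) | degSum-++ (lowerLast P) (lowerFirst S) = begin
      degSum P + (1 + degSum S) + (ifEmpty P + ifEmpty S)     ≡⟨ regroup (degSum P) (degSum S) (ifEmpty P) (ifEmpty S) ⟩
      (degSum P + ifEmpty P) + (degSum S + ifEmpty S) + 1     ≡⟨ cong₂ (λ x y → x + y + 1) (sym (degSum-lowerLast c P admP))
                                                                                     (sym (degSum-lowerFirst c S admS)) ⟩
      (degSum (lowerLast P) + 1) + (degSum (lowerFirst S) + 1) + 1 ≡⟨ regroup′ (degSum (lowerLast P)) (degSum (lowerFirst S)) ⟩
      degSum (lowerLast P) + degSum (lowerFirst S) + 3         ∎
      where
      open ≡-Reasoning
      regroup : ∀ p s i j → p + (1 + s) + (i + j) ≡ (p + i) + (s + j) + 1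
      regroup = solve-∀
      regroup′ : ∀ p s → (p + 1) + (s + 1) + 1 ≡ p + s + 3
      regroup′ = solve-∀

    divisible⁻ : LabelsDivisibleBy c L′ → LabelsDivisibleBy c L
    divisible⁻ c∣L′ = All.++⁺ c∣P (c∣r ∷ c∣S)
      where
      c∣P : LabelsDivisibleBy c P
      c∣P = All-lowerLast⁻ (c ∣_) P (All.++⁻ˡ (lowerLast P) c∣L′)
      c∣S : LabelsDivisibleBy c S
      c∣S = All-lowerFirst⁻ (c ∣_) S (All.++⁻ʳ (lowerLast P) c∣L′)
      c∣r : c ∣ r
      c∣r = subst (c ∣_) (sym r≡a+b) (∣m∣n⇒∣m+n (lastLabel-∣ c c P ∣-refl c∣P) (firstLabel-∣ c S c∣S))

  cycleFacts-contract : ∀ ℓ c d₀ P r S → 1 ≤ c → let L = P ++ (1 , r) ∷ S in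
    length L ≡ suc ℓ → All (Admissible c) L → Balanced c L c → d₀ * c ≡ firstLabel L c + lastLabel c L →
    (∀ d₀′ L′ → length L′ ≡ ℓ → All (Admissible c) L′ → Balanced c L′ c →
       d₀′ * c ≡ firstLabel L′ c + lastLabel c L′ → CycleFacts ℓ c d₀′ L′) →
    CycleFacts (suc ℓ) c d₀ L
  cycleFacts-contract ℓ c d₀ P r S c≥1 len adm bal rootEq facts =
    divisible⁻ (proj₁ facts′) ,
    sum-step (count c L) d₀ d₀′ (degSum L) (degSum L′) removed ℓ (sym (proj₁ (proj₂ reduced))) degSum-contract
      (subst (λ k → k + 1 + d₀′ + degSum L′ ≡ 3 * suc ℓ) (sym count-contract) (proj₁ (proj₂ facts′))) ,
    trans (continuant-contract c P r S admP admS)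
      (trans (proj₂ (proj₂ facts′)) (cong (λ k → ℤ.+ suc k) (sym count-contract)))
    where
    open Contraction c c≥1 P r S adm bal
    reduced : ∃[ d₀′ ] (d₀′ + removed ≡ d₀) × (d₀′ * c ≡ firstLabel L′ c + lastLabel c L′)
    reduced = root d₀ rootEq
    d₀′ : ℕ
    d₀′ = proj₁ reduced
    facts′ : CycleFacts ℓ c d₀′ L′
    facts′ = facts d₀′ L′ (ℕ.suc-injective (trans length-contract len)) admissible balanced (proj₂ (proj₂ reduced))
    sum-step : ∀ k d₀ d₀′ s s′ e ℓ → d₀ ≡ d₀′ + e → s + e ≡ s′ + 3 →
      k + 1 + d₀′ + s′ ≡ 3 * suc ℓ → k + 1 + d₀ + s ≡ 3 * suc (suc ℓ)
    sum-step k d₀ d₀′ s s′ e ℓ refl s+e≡s′+3 sum′ = ℕ.+-cancelʳ-≡ e _ _ (begin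
      k + 1 + (d₀′ + e) + s + e  ≡⟨ regroup k d₀′ s e ⟩
      k + 1 + d₀′ + (s + e) + e  ≡⟨ cong (λ t → k + 1 + d₀′ + t + e) s+e≡s′+3 ⟩
      k + 1 + d₀′ + (s′ + 3) + e ≡⟨ regroup′ k d₀′ s′ e ⟩
      k + 1 + d₀′ + s′ + 3 + e   ≡⟨ cong (λ t → t + 3 + e) sum′ ⟩
      3 * suc ℓ + 3 + e          ≡⟨ regroup″ ℓ e ⟩
      3 * suc (suc ℓ) + e        ∎)
      where
      open ≡-Reasoning
      regroup : ∀ k d s e → k + 1 + (d + e) + s + e ≡ k + 1 + d + (s + e) + e
      regroup = solve-∀
      regroup′ : ∀ k d s e → k + 1 + d + (s + 3) + e ≡ k + 1 + d + s + 3 + e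
      regroup′ = solve-∀
      regroup″ : ∀ ℓ e → 3 * suc ℓ + 3 + e ≡ 3 * suc (suc ℓ) + e
      regroup″ = solve-∀

  convexity : ∀ a L c → Balanced a L c → All ((2 ≤_) ∘ proj₁) L → firstLabel L c + lastLabel a L ≤ a + c
  convexity a []            c _          _          = ℕ.≤-reflexive (ℕ.+-comm c a)
  convexity a ((d , r) ∷ L) c (eq , bal) (2≤d ∷ 2≤L) = ℕ.+-cancelˡ-≤ r (r + lastLabel r L) (a + c) (begin
    r + (r + lastLabel r L)         ≡⟨ sym (ℕ.+-assoc r r _) ⟩
    (r + r) + lastLabel r L         ≤⟨ ℕ.+-monoˡ-≤ (lastLabel r L) 2r≤ ⟩
    (a + firstLabel L c) + lastLabel r L ≡⟨ ℕ.+-assoc a _ _ ⟩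
    a + (firstLabel L c + lastLabel r L) ≤⟨ ℕ.+-monoʳ-≤ a (convexity r L c bal 2≤L) ⟩
    a + (r + c)                     ≡⟨ swap a r c ⟩
    r + (a + c)                     ∎)
    where
    open ℕ.≤-Reasoning
    swap : ∀ a r c → a + (r + c) ≡ r + (a + c)
    swap = solve-∀
    2r≤ : r + r ≤ a + firstLabel L c
    2r≤ = ℕ.≤-trans (ℕ.≤-reflexive (cong (r +_) (sym (ℕ.+-identityʳ r))))
            (ℕ.≤-trans (ℕ.*-monoˡ-≤ r 2≤d) (ℕ.≤-reflexive eq))

  Flat : ℕ → Node → Set
  Flat c (d , r) = d ≡ 2 × r ≡ c

  firstLabel-flat : ∀ c L → All (Flat c) L → firstLabel L c ≡ c
  firstLabel-flat c []            _            = refl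
  firstLabel-flat c ((d , r) ∷ L) ((_ , r≡c) ∷ _) = r≡c

  lastLabel-flat : ∀ c L → All (Flat c) L → lastLabel c L ≡ c
  lastLabel-flat c []            _                 = refl
  lastLabel-flat c ((d , r) ∷ L) ((_ , refl) ∷ flat) = lastLabel-flat c L flat

  -- Labels are ≥ c and convex between two ends labelled c, hence constant.
  flatten : ∀ c L → .{{_ : ℕ.NonZero c}} → Balanced c L c → All ((2 ≤_) ∘ proj₁) L → All (Admissible c) L →
    All (Flat c) L
  flatten c []            _          _           _                 = []
  flatten c ((d , r) ∷ L) (eq , bal) (2≤d ∷ 2≤L) ((_ , c≤r) ∷ adm) = (d≡2 , r≡c) ∷ rest
    where
    r≡c : r ≡ c
    r≡c = ℕ.≤-antisym
      (ℕ.+-cancelʳ-≤ c r c (ℕ.≤-trans (ℕ.+-monoʳ-≤ r (lastLabel-≥ c r L c≤r adm))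
                                      (convexity c ((d , r) ∷ L) c (eq , bal) (2≤d ∷ 2≤L))))
      c≤r
    rest : All (Flat c) L
    rest = flatten c L (subst (λ x → Balanced x L c) r≡c bal) 2≤L adm
    d≡2 : d ≡ 2
    d≡2 = ℕ.*-cancelʳ-≡ d 2 c (begin
      d * c                  ≡⟨ cong (d *_) (sym r≡c) ⟩
      d * r                  ≡⟨ eq ⟩
      c + firstLabel L c     ≡⟨ cong (c +_) (firstLabel-flat c L rest) ⟩
      c + c                  ≡⟨ cong (c +_) (sym (ℕ.+-identityʳ c)) ⟩
      2 * c                  ∎)
      where open ≡-Reasoning

  count-flat : ∀ c L → All (Flat c) L → count c L ≡ length L
  count-flat c []            _                 = refl
  count-flat c ((d , r) ∷ L) ((_ , refl) ∷ flat) rewrite ≡ᵇ-refl c = cong suc (count-flat c L flat)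

  degSum-flat : ∀ c L → All (Flat c) L → degSum L ≡ length L + length L
  degSum-flat c []            _                 = refl
  degSum-flat c ((d , r) ∷ L) ((refl , _) ∷ flat) rewrite degSum-flat c L flat =
    cong suc (sym (ℕ.+-suc (length L) (length L)))

  private
    two-step : ∀ k → ℤ.+ 2 ℤ.* (ℤ.+ 1 ℤ.+ k) ℤ.- k ≡ ℤ.+ 1 ℤ.+ (ℤ.+ 1 ℤ.+ k)
    two-step = solveℤ-∀

  continue-flat : ∀ c k L → All (Flat c) L →
    continue (degrees L) (ℤ.+ k , ℤ.+ suc k) ≡ (ℤ.+ (k + length L) , ℤ.+ suc (k + length L))
  continue-flat c k []            _ rewrite ℕ.+-identityʳ k = refl
  continue-flat c k ((d , r) ∷ L) ((refl , _) ∷ flat)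
    rewrite two-step (ℤ.+ k) | continue-flat c (suc k) L flat | ℕ.+-suc k (length L) = refl

  cycleFacts-flat : ∀ ℓ c d₀ L → length L ≡ ℓ → .{{_ : ℕ.NonZero c}} → All (Admissible c) L → Balanced c L c →
    d₀ * c ≡ firstLabel L c + lastLabel c L → All ((2 ≤_) ∘ proj₁) L → CycleFacts ℓ c d₀ L
  cycleFacts-flat ℓ c d₀ L refl adm bal rootEq 2≤L
    with flat ← flatten c L bal 2≤L adm
    with refl ← ℕ.*-cancelʳ-≡ d₀ 2 c (trans rootEq (trans (cong₂ _+_ (firstLabel-flat c L flat) (lastLabel-flat c L flat))
                                                           (cong (c +_) (sym (ℕ.+-identityʳ c)))))
    rewrite count-flat c L flat | degSum-flat c L flat
    = All.map c∣label flat , total (length L) , cong proj₂ (continue-flat c 0 L flat)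
    where
    c∣label : ∀ {x} → Flat c x → c ∣ proj₂ x
    c∣label (_ , refl) = ∣-refl
    total : ∀ ℓ → ℓ + 1 + 2 + (ℓ + ℓ) ≡ 3 * suc ℓ
    total = solve-∀

  cycleFacts : ∀ ℓ c d₀ L → length L ≡ ℓ → 1 ≤ c → All (Admissible c) L → Balanced c L c →
    d₀ * c ≡ firstLabel L c + lastLabel c L → CycleFacts ℓ c d₀ L
  cycleFacts ℓ c d₀ L len c≥1 adm bal rootEq with Any.any? (λ x → proj₁ x ≟ 1) L
  ... | no ¬deg1 = cycleFacts-flat ℓ c d₀ L len {{ℕ.>-nonZero c≥1}} adm bal rootEq
                     (All.zipWith 2≤ (All.¬Any⇒All¬ L ¬deg1 , adm))
    where
    2≤ : ∀ {x} → ¬ proj₁ x ≡ 1 × Admissible c x → 2 ≤ proj₁ x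
    2≤ {zero , _}        (_ , (() , _))
    2≤ {suc zero , _}    (d≢1 , _) = ⊥-elim (d≢1 refl)
    2≤ {suc (suc d) , _} _         = s≤s (s≤s z≤n)
  ... | yes deg1 with (1 , r) , x∈L , refl ← find deg1 with P , S , refl ← ∈-∃++ x∈L with ℓ
  ...   | zero  = ⊥-elim (ℕ.0≢1+n (trans (sym len) (trans (List.length-++ P) (ℕ.+-suc (length P) (length S)))))
  ...   | suc ℓ′ = cycleFacts-contract ℓ′ c d₀ P r S c≥1 len adm bal rootEq
                     (λ d₀′ L′ len′ → cycleFacts ℓ′ c d₀′ L′ len′ c≥1)

module Segments where

  open import Data.Nat as ℕ using (ℕ; zero; suc; _+_; _*_; _<_; _≡ᵇ_; z≤n; s≤s)
  import Data.Nat.Properties as ℕ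
  open import Data.Integer as ℤ using (ℤ)
  import Data.Integer.Properties as ℤ
  open import Data.Product using (_,_; proj₁; proj₂)
  open import Data.List using (List; []; _∷_; _∷ʳ_; length)
  import Data.List.Properties as List
  open import Data.List.Relation.Unary.All using (All; []; _∷_)
  open import Data.Bool using (if_then_else_)
  open import Data.Unit using (tt)
  open import Relation.Binary.PropositionalEquality
  open BalancedPaths
  open import Function using (_∘′_)
  open Recurrence using (run; step; unforced)

  window : (ℕ → ℕ) → ℕ → ℕ → ℕ
  window h a zero    = 0
  window h a (suc ℓ) = h a ℕ.+ window h (suc a) ℓ

  node : (ℕ → ℕ) → (ℕ → ℕ) → ℕ → Node
  node D R k = (D k , R k)

  segment : (ℕ → Node) → ℕ → ℕ → List Node
  segment g a zero    = []
  segment g a (suc ℓ) = g a ∷ segment g (suc a) ℓ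

  length-segment : ∀ g a ℓ → length (segment g a ℓ) ≡ ℓ
  length-segment g a zero    = refl
  length-segment g a (suc ℓ) = cong suc (length-segment g (suc a) ℓ)

  All-segment : ∀ {Q : Node → Set} g a ℓ → (∀ k → Q (g k)) → All Q (segment g a ℓ)
  All-segment g a zero    q = []
  All-segment g a (suc ℓ) q = q a ∷ All-segment g (suc a) ℓ q

  All-segment⁻ : ∀ {Q : Node → Set} g a ℓ → All Q (segment g a ℓ) → ∀ j → j < ℓ → Q (g (a + j))
  All-segment⁻ {Q} g a (suc ℓ) (q ∷ qs) zero    _ = subst (Q ∘′ g) (sym (ℕ.+-identityʳ a)) q
  All-segment⁻ {Q} g a (suc ℓ) (q ∷ qs) (suc j) (s≤s j<ℓ) =
    subst (Q ∘′ g) (sym (ℕ.+-suc a j)) (All-segment⁻ g (suc a) ℓ qs j j<ℓ)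

  segment-suc : ∀ g a ℓ → segment g a (suc ℓ) ≡ segment g a ℓ ∷ʳ g (a + ℓ)
  segment-suc g a zero    = cong (λ z → g z ∷ []) (sym (ℕ.+-identityʳ a))
  segment-suc g a (suc ℓ) = cong (g a ∷_) (trans (segment-suc g (suc a) ℓ)
                              (cong (λ z → segment g (suc a) ℓ ∷ʳ g z) (sym (ℕ.+-suc a ℓ))))

  firstLabel-segment : ∀ D R b ℓ → firstLabel (segment (node D R) (suc b) ℓ) (R (suc (b + ℓ))) ≡ R (suc b)
  firstLabel-segment D R b zero    = cong (λ z → R (suc z)) (ℕ.+-identityʳ b)
  firstLabel-segment D R b (suc ℓ) = refl

  lastLabel-segment : ∀ D R a ℓ → lastLabel (R a) (segment (node D R) (suc a) ℓ) ≡ R (a + ℓ)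
  lastLabel-segment D R a zero    = cong R (sym (ℕ.+-identityʳ a))
  lastLabel-segment D R a (suc ℓ) = trans (lastLabel-segment D R (suc a) ℓ) (cong R (sym (ℕ.+-suc a ℓ)))

  Balanced-segment : ∀ D R a ℓ →
    (∀ j → j < ℓ → D (suc (a + j)) * R (suc (a + j)) ≡ R (a + j) + R (suc (suc (a + j)))) →
    Balanced (R a) (segment (node D R) (suc a) ℓ) (R (suc (a + ℓ)))
  Balanced-segment D R a zero    bal = tt
  Balanced-segment D R a (suc ℓ) bal =
    trans (subst (λ z → D (suc z) * R (suc z) ≡ R z + R (suc (suc z))) (ℕ.+-identityʳ a) (bal 0 (s≤s z≤n)))
      (cong (R a +_) (sym (trans (cong (λ z → firstLabel (segment (node D R) (suc (suc a)) ℓ) (R (suc z))) (ℕ.+-suc a ℓ))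
                                 (firstLabel-segment D R (suc a) ℓ)))) ,
    subst (λ z → Balanced (R (suc a)) (segment (node D R) (suc (suc a)) ℓ) (R (suc z))) (sym (ℕ.+-suc a ℓ))
      (Balanced-segment D R (suc a) ℓ
        (λ j j<ℓ → subst (λ z → D (suc z) * R (suc z) ≡ R z + R (suc (suc z))) (ℕ.+-suc a j) (bal (suc j) (s≤s j<ℓ))))

  degSum-segment : ∀ g a ℓ → degSum (segment g a ℓ) ≡ window (proj₁ ∘′ g) a ℓ
  degSum-segment g a zero    = refl
  degSum-segment g a (suc ℓ) = cong (proj₁ (g a) +_) (degSum-segment g (suc a) ℓ)

  count-segment : ∀ c g a ℓ → count c (segment g a ℓ) ≡ window (λ k → if proj₂ (g k) ≡ᵇ c then 1 else 0) a ℓ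
  count-segment c g a zero    = refl
  count-segment c g a (suc ℓ) = cong (_ +_) (count-segment c g (suc a) ℓ)

  run-continue : ∀ D R a ℓ uv → run D unforced a ℓ uv ≡ continue (degrees (segment (node D R) (suc a) ℓ)) uv
  run-continue D R a zero    uv = refl
  run-continue D R a (suc ℓ) uv = begin
    step D unforced k (run D unforced a ℓ uv)                  ≡⟨ cong (step D unforced k) (run-continue D R a ℓ uv) ⟩
    step D unforced k (continue (degrees S) uv)                ≡⟨ step-continue (continue (degrees S) uv) ⟩
    continue (D k ∷ []) (continue (degrees S) uv)              ≡⟨ sym (continue-++ (degrees S) (D k ∷ []) uv) ⟩
    continue (degrees S ∷ʳ D k) uv
      ≡⟨ cong (λ ds → continue ds uv) (sym (List.map-++ proj₁ S (node D R k ∷ []))) ⟩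
    continue (degrees (S ∷ʳ node D R k)) uv
      ≡⟨ cong (λ xs → continue (degrees xs) uv) (sym (segment-suc (node D R) (suc a) ℓ)) ⟩
    continue (degrees (segment (node D R) (suc a) (suc ℓ))) uv ∎
    where
    open ≡-Reasoning
    k : ℕ
    k = suc (a + ℓ)
    S : List Node
    S = segment (node D R) (suc a) ℓ
    step-continue : ∀ p → step D unforced k p ≡ continue (D k ∷ []) p
    step-continue (u , v) = cong (v ,_) (ℤ.+-identityʳ _)

module CycleIndex (m : ℕ) where

  open import Data.Nat as ℕ using (ℕ; zero; suc; _≡ᵇ_; _<_)
  import Data.Nat.Properties as ℕ
  open import Data.Nat.DivMod using (_%_; m%n<n; [m+n]%n≡m%n; [m+kn]%n≡m%n; m<n⇒m%n≡m; %-distribˡ-+; m%n%n≡m%n; n%n≡0)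
  open import Data.Integer as ℤ using (ℤ; +_; _-_)
  import Data.Integer.Properties as ℤ
  open import Data.Fin as Fin using (Fin; toℕ; fromℕ<)
  import Data.Fin.Properties as Fin
  open import Data.Bool using (Bool; true; false; if_then_else_; T)
  open import Data.Unit using (tt)
  open import Data.Empty using (⊥-elim)
  open import Data.Sum using (_⊎_; inj₁; inj₂)
  open import Data.Product using (_×_; _,_; ∃)
  open import Relation.Nullary using (¬_)
  open import Relation.Binary.PropositionalEquality
  open BalancedPaths using (≡ᵇ-refl)
  open Segments using (window)
  open import Data.Nat.Tactic.RingSolver using (solve-∀)
  open import Algebra.Properties.CommutativeSemigroup ℤ.+-commutativeSemigroup using (interchange)

  n : ℕ
  n = suc m

  vertex : ℕ → Fin n
  vertex k = fromℕ< (m%n<n k n)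

  -- A function on the vertices, read along the infinite walk 0, 1, 2, … around the cycle.
  cyclic : ∀ {A : Set} → (Fin n → A) → ℕ → A
  cyclic f k = f (vertex k)

  toℕ-vertex : ∀ k → toℕ (vertex k) ≡ k % n
  toℕ-vertex k = Fin.toℕ-fromℕ< (m%n<n k n)

  vertex-cong : ∀ a b → a % n ≡ b % n → vertex a ≡ vertex b
  vertex-cong a b eq = Fin.fromℕ<-cong (a % n) (b % n) eq (m%n<n a n) (m%n<n b n)

  vertex-toℕ : ∀ i → vertex (toℕ i) ≡ i
  vertex-toℕ i = trans (Fin.fromℕ<-cong _ (toℕ i) (m<n⇒m%n≡m (Fin.toℕ<n i)) (m%n<n (toℕ i) n) (Fin.toℕ<n i))
                       (Fin.fromℕ<-toℕ i (Fin.toℕ<n i))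

  cyclic-periodic : ∀ {A : Set} (f : Fin n → A) k → cyclic f (k ℕ.+ n) ≡ cyclic f k
  cyclic-periodic f k = cong f (vertex-cong (k ℕ.+ n) k ([m+n]%n≡m%n k n))

  [m%n+k]%n≡[m+k]%n : ∀ a k → ((a % n) ℕ.+ k) % n ≡ (a ℕ.+ k) % n
  [m%n+k]%n≡[m+k]%n a k = trans (%-distribˡ-+ (a % n) k n)
    (trans (cong (λ z → (z ℕ.+ k % n) % n) (m%n%n≡m%n a n)) (sym (%-distribˡ-+ a k n)))

  next prev : Fin n → Fin n
  next i = vertex (suc (toℕ i))
  prev i = vertex (toℕ i ℕ.+ m)

  indicator : Bool → ℤ
  indicator b = if b then + 1 else + 0

  sumℤ-+ : ∀ {N} (f g : Fin N → ℤ) → sumℤ (λ j → f j ℤ.+ g j) ≡ sumℤ f ℤ.+ sumℤ g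
  sumℤ-+ {zero}  f g = refl
  sumℤ-+ {suc N} f g rewrite sumℤ-+ (λ j → f (Fin.suc j)) (λ j → g (Fin.suc j)) =
    interchange (f Fin.zero) (g Fin.zero) _ _

  sumℤ-cong : ∀ {N} (f g : Fin N → ℤ) → (∀ j → f j ≡ g j) → sumℤ f ≡ sumℤ g
  sumℤ-cong {zero}  f g f≗g = refl
  sumℤ-cong {suc N} f g f≗g = cong₂ ℤ._+_ (f≗g Fin.zero) (sumℤ-cong _ _ (λ j → f≗g (Fin.suc j)))

  sumℤ-select-none : ∀ {N} (p : Fin N → Bool) (x : Fin N → ℤ) → (∀ j → ¬ T (p j)) →
    sumℤ (λ j → indicator (p j) ℤ.* x j) ≡ + 0
  sumℤ-select-none {zero}  p x none = refl
  sumℤ-select-none {suc N} p x none with p Fin.zero in eq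
  ... | true  = ⊥-elim (none Fin.zero (subst T (sym eq) tt))
  ... | false = trans (ℤ.+-identityˡ _) (sumℤ-select-none (λ j → p (Fin.suc j)) (λ j → x (Fin.suc j)) (λ j → none (Fin.suc j)))

  sumℤ-select : ∀ {N} (p : Fin N → Bool) (x : Fin N → ℤ) a → (∀ j → T (p j) → j ≡ a) → T (p a) →
    sumℤ (λ j → indicator (p j) ℤ.* x j) ≡ x a
  sumℤ-select {suc N} p x Fin.zero only pa with p Fin.zero in eq
  ... | true = trans (cong (ℤ._+_ (+ 1 ℤ.* x Fin.zero))
                       (sumℤ-select-none (λ j → p (Fin.suc j)) (λ j → x (Fin.suc j)) (λ j pj → Fin.0≢1+n (sym (only (Fin.suc j) pj)))))
                     (trans (ℤ.+-identityʳ _) (ℤ.*-identityˡ (x Fin.zero)))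
  sumℤ-select {suc N} p x (Fin.suc a) only pa with p Fin.zero in eq
  ... | true  = ⊥-elim (Fin.0≢1+n (only Fin.zero (subst T (sym eq) tt)))
  ... | false = trans (ℤ.+-identityˡ _)
                  (sumℤ-select (λ j → p (Fin.suc j)) (λ j → x (Fin.suc j)) a (λ j pj → Fin.suc-injective (only (Fin.suc j) pj)) pa)

  isNext-sound : ∀ a b → b < n → T (isNext n a b) → b ≡ suc a % n
  isNext-sound a b b<n t with suc a ≡ᵇ b in e₁
  ... | true with refl ← ℕ.≡ᵇ⇒≡ (suc a) b (subst T (sym e₁) tt) = sym (m<n⇒m%n≡m b<n)
  isNext-sound a b b<n t | false with suc a ≡ᵇ n in e₂ | b ≡ᵇ 0 in e₃
  isNext-sound a b b<n t  | false | true  | true with refl ← ℕ.≡ᵇ⇒≡ b 0 (subst T (sym e₃) tt) =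
    sym (trans (cong (_% n) (ℕ.≡ᵇ⇒≡ (suc a) n (subst T (sym e₂) tt))) (n%n≡0 n))
  isNext-sound a b b<n () | false | true  | false
  isNext-sound a b b<n () | false | false | _

  isNext-complete : ∀ a → a < n → T (isNext n a (suc a % n))
  isNext-complete a a<n with ℕ.m≤n⇒m<n∨m≡n a<n
  ... | inj₁ 1+a<n rewrite m<n⇒m%n≡m 1+a<n | ≡ᵇ-refl (suc a) = tt
  ... | inj₂ 1+a≡n with refl ← ℕ.suc-injective 1+a≡n = subst (λ b → T (isNext n m b)) (sym (n%n≡0 n)) wraps
    where
    wraps : T (isNext n m 0)
    wraps rewrite ≡ᵇ-refl m = tt

  prev-vertex-suc : ∀ j → prev (vertex (suc j)) ≡ vertex j
  prev-vertex-suc j = vertex-cong (toℕ (vertex (suc j)) ℕ.+ m) j (begin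
    (toℕ (vertex (suc j)) ℕ.+ m) % n          ≡⟨ cong (λ z → (z ℕ.+ m) % n) (toℕ-vertex (suc j)) ⟩
    (suc j % n ℕ.+ m) % n                     ≡⟨ [m%n+k]%n≡[m+k]%n (suc j) m ⟩
    (suc j ℕ.+ m) % n                         ≡⟨ cong (_% n) (sym (ℕ.+-suc j m)) ⟩
    (j ℕ.+ n) % n                             ≡⟨ [m+n]%n≡m%n j n ⟩
    j % n                                     ∎)
    where open ≡-Reasoning

  vertex-suc-toℕ : ∀ i → vertex (suc (toℕ (vertex i))) ≡ vertex (suc i)
  vertex-suc-toℕ i = vertex-cong (suc (toℕ (vertex i))) (suc i) (begin
    suc (toℕ (vertex i)) % n ≡⟨ cong (λ z → suc z % n) (toℕ-vertex i) ⟩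
    suc (i % n) % n          ≡⟨ cong (_% n) (ℕ.+-comm 1 (i % n)) ⟩
    (i % n ℕ.+ 1) % n        ≡⟨ [m%n+k]%n≡[m+k]%n i 1 ⟩
    (i ℕ.+ 1) % n            ≡⟨ cong (_% n) (ℕ.+-comm i 1) ⟩
    suc i % n                ∎)
    where open ≡-Reasoning

  next-unique : ∀ i j → T (isNext n (toℕ i) (toℕ j)) → j ≡ next i
  next-unique i j t = Fin.toℕ-injective
    (trans (isNext-sound (toℕ i) (toℕ j) (Fin.toℕ<n j) t) (sym (toℕ-vertex (suc (toℕ i)))))

  next-adjacent : ∀ i → T (isNext n (toℕ i) (toℕ (next i)))
  next-adjacent i = subst (λ z → T (isNext n (toℕ i) z)) (sym (toℕ-vertex (suc (toℕ i))))
    (isNext-complete (toℕ i) (Fin.toℕ<n i))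

  prev-next : ∀ j → prev (next j) ≡ j
  prev-next j = trans (prev-vertex-suc (toℕ j)) (vertex-toℕ j)

  next-prev : ∀ i → next (prev i) ≡ i
  next-prev i = trans (vertex-suc-toℕ (toℕ i ℕ.+ m)) (trans (cong vertex (sym (ℕ.+-suc (toℕ i) m)))
                  (trans (cyclic-periodic (λ k → k) (toℕ i)) (vertex-toℕ i)))

  prev-unique : ∀ i j → T (isNext n (toℕ j) (toℕ i)) → j ≡ prev i
  prev-unique i j t = trans (sym (prev-next j)) (cong prev (sym (next-unique j i t)))

  prev-adjacent : ∀ i → T (isNext n (toℕ (prev i)) (toℕ i))
  prev-adjacent i = subst (λ k → T (isNext n (toℕ (prev i)) (toℕ k))) (next-prev i) (next-adjacent (prev i))

  lap-cycle : ∀ d x i → lap n d x i ≡ + d i ℤ.* x i - (x (next i) ℤ.+ x (prev i))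
  lap-cycle d x i = cong (λ z → + d i ℤ.* x i - z) (begin
    sumℤ (λ j → adj n i j ℤ.* x j)
      ≡⟨ sumℤ-cong _ _ (λ j → ℤ.*-distribʳ-+ (x j) (indicator (out j)) (indicator (in′ j))) ⟩
    sumℤ (λ j → indicator (out j) ℤ.* x j ℤ.+ indicator (in′ j) ℤ.* x j)
      ≡⟨ sumℤ-+ (λ j → indicator (out j) ℤ.* x j) (λ j → indicator (in′ j) ℤ.* x j) ⟩
    sumℤ (λ j → indicator (out j) ℤ.* x j) ℤ.+ sumℤ (λ j → indicator (in′ j) ℤ.* x j)
      ≡⟨ cong₂ ℤ._+_ (sumℤ-select out x (next i) (next-unique i) (next-adjacent i))
                     (sumℤ-select in′ x (prev i) (prev-unique i) (prev-adjacent i)) ⟩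
    x (next i) ℤ.+ x (prev i) ∎)
    where
    open ≡-Reasoning
    out in′ : Fin n → Bool
    out j = isNext n (toℕ i) (toℕ j)
    in′ j = isNext n (toℕ j) (toℕ i)

  lap-at : ∀ d x k → lap n d x (vertex (suc k)) ≡
    + cyclic d (suc k) ℤ.* cyclic x (suc k) - (cyclic x (suc (suc k)) ℤ.+ cyclic x k)
  lap-at d x k = trans (lap-cycle d x (vertex (suc k)))
    (cong₂ (λ a b → + cyclic d (suc k) ℤ.* cyclic x (suc k) - (x a ℤ.+ x b))
      (vertex-suc-toℕ (suc k)) (prev-vertex-suc k))

  -- offset s i is the number of steps from vertex s forward to i.
  offset : ℕ → Fin n → ℕ
  offset s i = (toℕ i ℕ.+ m ℕ.* s) % n

  fromWalk : ∀ {A : Set} → ℕ → (ℕ → A) → Fin n → A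
  fromWalk s g i = g (offset s i)

  private
    unwind : ∀ s j m → s ℕ.+ j ℕ.+ m ℕ.* s ≡ j ℕ.+ s ℕ.* suc m
    unwind = solve-∀
    unwind′ : ∀ i s m → i ℕ.+ m ℕ.* s ℕ.+ s ≡ i ℕ.+ s ℕ.* suc m
    unwind′ = solve-∀

  cyclic-fromWalk : ∀ {A : Set} s (g : ℕ → A) j → j < n → cyclic (fromWalk s g) (s ℕ.+ j) ≡ g j
  cyclic-fromWalk s g j j<n = cong g (begin
    (toℕ (vertex (s ℕ.+ j)) ℕ.+ m ℕ.* s) % n ≡⟨ cong (λ z → (z ℕ.+ m ℕ.* s) % n) (toℕ-vertex (s ℕ.+ j)) ⟩
    ((s ℕ.+ j) % n ℕ.+ m ℕ.* s) % n          ≡⟨ [m%n+k]%n≡[m+k]%n (s ℕ.+ j) (m ℕ.* s) ⟩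
    (s ℕ.+ j ℕ.+ m ℕ.* s) % n                ≡⟨ cong (_% n) (unwind s j m) ⟩
    (j ℕ.+ s ℕ.* n) % n                      ≡⟨ [m+kn]%n≡m%n j s n ⟩
    j % n                                    ≡⟨ m<n⇒m%n≡m j<n ⟩
    j                                        ∎)
    where open ≡-Reasoning

  vertex-offset : ∀ s i → vertex (s ℕ.+ offset s i) ≡ i
  vertex-offset s i = trans (vertex-cong (s ℕ.+ offset s i) (toℕ i) (begin
    (s ℕ.+ (toℕ i ℕ.+ m ℕ.* s) % n) % n ≡⟨ cong (_% n) (ℕ.+-comm s _) ⟩
    ((toℕ i ℕ.+ m ℕ.* s) % n ℕ.+ s) % n ≡⟨ [m%n+k]%n≡[m+k]%n (toℕ i ℕ.+ m ℕ.* s) s ⟩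
    (toℕ i ℕ.+ m ℕ.* s ℕ.+ s) % n       ≡⟨ cong (_% n) (unwind′ (toℕ i) s m) ⟩
    (toℕ i ℕ.+ s ℕ.* n) % n             ≡⟨ [m+kn]%n≡m%n (toℕ i) s n ⟩
    toℕ i % n                           ∎)) (vertex-toℕ i)
    where open ≡-Reasoning

  vertex-at-offset : ∀ s i {k} → offset s i ≡ k → i ≡ vertex (s ℕ.+ k)
  vertex-at-offset s i eq = trans (sym (vertex-offset s i)) (cong (λ z → vertex (s ℕ.+ z)) eq)

  vertex-split : ∀ s i → i ≡ vertex s ⊎ ∃ λ j → j < m × i ≡ vertex (suc (s ℕ.+ j))
  vertex-split s i with offset s i in eq | m%n<n (toℕ i ℕ.+ m ℕ.* s) n
  ... | zero  | _     = inj₁ (trans (vertex-at-offset s i eq) (cong vertex (ℕ.+-identityʳ s)))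
  ... | suc j | 1+j<n = inj₂ (j , ℕ.≤-pred 1+j<n , trans (vertex-at-offset s i eq) (cong vertex (ℕ.+-suc s j)))

  window-suc : ∀ h a ℓ → window h a (suc ℓ) ≡ window h a ℓ ℕ.+ h (a ℕ.+ ℓ)
  window-suc h a zero    = trans (ℕ.+-identityʳ (h a)) (cong h (sym (ℕ.+-identityʳ a)))
  window-suc h a (suc ℓ) = trans (cong (h a ℕ.+_) (window-suc h (suc a) ℓ))
    (trans (sym (ℕ.+-assoc (h a) _ _)) (cong (window h a (suc ℓ) ℕ.+_) (cong h (sym (ℕ.+-suc a ℓ)))))

  window-rotate : ∀ (f : Fin n → ℕ) a → window (cyclic f) a n ≡ window (cyclic f) (suc a) n
  window-rotate f a = begin
    cyclic f a ℕ.+ window (cyclic f) (suc a) m ≡⟨ ℕ.+-comm (cyclic f a) _ ⟩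
    window (cyclic f) (suc a) m ℕ.+ cyclic f a ≡⟨ cong (window (cyclic f) (suc a) m ℕ.+_)
                                                   (sym (trans (cong (cyclic f) (sym (ℕ.+-suc a m))) (cyclic-periodic f a))) ⟩
    window (cyclic f) (suc a) m ℕ.+ cyclic f (suc a ℕ.+ m) ≡⟨ sym (window-suc (cyclic f) (suc a) m) ⟩
    window (cyclic f) (suc a) n ∎
    where open ≡-Reasoning

  window-shift : ∀ h a ℓ → window (λ k → h (suc k)) a ℓ ≡ window h (suc a) ℓ
  window-shift h a zero    = refl
  window-shift h a (suc ℓ) = cong (h (suc a) ℕ.+_) (window-shift h (suc a) ℓ)

  sumℕ-window₀ : ∀ {N} (g : Fin N → ℕ) (h : ℕ → ℕ) → (∀ i → g i ≡ h (toℕ i)) → sumℕ g ≡ window h 0 N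
  sumℕ-window₀ {zero}  g h g≗h = refl
  sumℕ-window₀ {suc N} g h g≗h = cong₂ ℕ._+_ (g≗h Fin.zero)
    (trans (sumℕ-window₀ (λ i → g (Fin.suc i)) (λ k → h (suc k)) (λ i → g≗h (Fin.suc i))) (window-shift h 0 N))

  sumℕ-window : ∀ (f : Fin n → ℕ) s → sumℕ f ≡ window (cyclic f) s n
  sumℕ-window f zero    = sumℕ-window₀ f (cyclic f) (λ i → cong f (sym (vertex-toℕ i)))
  sumℕ-window f (suc s) = trans (sumℕ-window f s) (window-rotate f s)
module FinFamilies where

  open import Data.Nat as ℕ using (ℕ; zero; suc; _≤_)
  import Data.Nat.Properties as ℕ
  open import Data.Nat.Divisibility as ℕ using (_∣_)
  open import Data.Nat.GCD using (gcd-greatest)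
  open import Data.Fin as Fin using (Fin)
  open import Data.Product using (_,_; ∃)
  open import Relation.Nullary using (yes; no)

  argmin : ∀ {N} (f : Fin (suc N) → ℕ) → ∃ λ v → ∀ i → f v ≤ f i
  argmin {zero}  f = Fin.zero , λ { Fin.zero → ℕ.≤-refl }
  argmin {suc N} f with argmin (λ i → f (Fin.suc i))
  ... | w , min with f Fin.zero ℕ.≤? f (Fin.suc w)
  ...   | yes f₀≤ = Fin.zero , λ { Fin.zero → ℕ.≤-refl ; (Fin.suc i) → ℕ.≤-trans f₀≤ (min i) }
  ...   | no  f₀≰ = Fin.suc w , λ { Fin.zero → ℕ.<⇒≤ (ℕ.≰⇒> f₀≰) ; (Fin.suc i) → min i }

  gcdAll-greatest : ∀ {N} (f : Fin N → ℕ) e → (∀ i → e ∣ f i) → e ∣ gcdAll f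
  gcdAll-greatest {zero}  f e e∣f = e ℕ.∣0
  gcdAll-greatest {suc N} f e e∣f =
    gcd-greatest (e∣f Fin.zero) (gcdAll-greatest (λ i → f (Fin.suc i)) e (λ i → e∣f (Fin.suc i)))


module ArithmeticalStructureOnCycle (m′ : ℕ) (d r : Fin (ℕ.suc (ℕ.suc m′)) → ℕ)
  (arith : IsArithStructure (ℕ.suc (ℕ.suc m′)) d r) where

  open import Data.Nat as ℕ using (ℕ; zero; suc; _≤_; _<_; z≤n; s≤s)
  import Data.Nat.Properties as ℕ
  open import Data.Nat.Divisibility as ℕ using (_∣_)
  open import Data.Integer as ℤ using (ℤ; +_; -_; _+_; _*_; _-_)
  import Data.Integer.Properties as ℤ
  open import Data.Integer.Tactic.RingSolver using (solve-∀)
  open import Data.Fin as Fin using (Fin; toℕ)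
  open import Data.Bool using (if_then_else_)
  open import Data.Product using (Σ; _×_; _,_; proj₁; proj₂; ∃; ∃-syntax)
  open import Data.Sum using (_⊎_; inj₁; inj₂; fromInj₂)
  open import Data.List using (List)
  open import Data.List.Relation.Unary.All using (All)
  open import Relation.Nullary.Decidable using (dec-false)
  open import Data.Integer.Divisibility using () renaming (_∣_ to _∣ℤ_)
  open import Data.Integer.Divisibility.Signed as Signed using (divides; quotient; ∣ᵤ⇒∣; ∣⇒∣ᵤ)
  open import Relation.Binary.PropositionalEquality
  open Recurrence
  open BalancedPaths
    using (≡ᵇ-refl; Node; Admissible; Balanced; firstLabel; lastLabel; count; degSum; CycleFacts; cycleFacts)
  open Segments
  open FinFamilies

  m : ℕ
  m = suc m′

  open CycleIndex m

  D R : ℕ → ℕ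
  D = cyclic d
  R = cyclic r

  -- The walk starts at a vertex of minimal label c.
  root : Fin n
  root = proj₁ (argmin r)

  s : ℕ
  s = toℕ root

  c : ℕ
  c = r root

  R-root : R s ≡ c
  R-root = cong r (vertex-toℕ root)

  -- After the m interior vertices s+1, …, s+m the walk is back at the root.
  s⁻ s⁺ : ℕ
  s⁻ = s ℕ.+ m
  s⁺ = suc s⁻

  wrap : ∀ {A : Set} (f : Fin n → A) → cyclic f s⁺ ≡ cyclic f s
  wrap f = trans (cong (cyclic f) (sym (ℕ.+-suc s m))) (cyclic-periodic f s)

  wrap₁ : ∀ {A : Set} (f : Fin n → A) → cyclic f (suc s⁺) ≡ cyclic f (suc s)
  wrap₁ f = trans (cong (cyclic f) (cong suc (sym (ℕ.+-suc s m)))) (cyclic-periodic f (suc s))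

  balance₀ : ∀ k → + 0 ≡ + D (suc k) * + R (suc k) - (+ R (suc (suc k)) + + R k)
  balance₀ k = trans (sym (proj₂ (proj₂ (proj₂ arith)) (vertex (suc k)))) (lap-at d (λ j → + r j) k)

  balance : ∀ k → D (suc k) ℕ.* R (suc k) ≡ R k ℕ.+ R (suc (suc k))
  balance k = ℤ.+-injective (begin
    + (D (suc k) ℕ.* R (suc k))  ≡⟨ ℤ.pos-* (D (suc k)) (R (suc k)) ⟩
    + D (suc k) * + R (suc k)    ≡⟨ ℤ.i-j≡0⇒i≡j _ _ (sym (balance₀ k)) ⟩
    + R (suc (suc k)) + + R k    ≡⟨ ℤ.+-comm (+ R (suc (suc k))) (+ R k) ⟩
    + R k + + R (suc (suc k))    ≡⟨ sym (ℤ.pos-+ (R k) (R (suc (suc k)))) ⟩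
    + (R k ℕ.+ R (suc (suc k)))  ∎)
    where open ≡-Reasoning

  interior : List Node
  interior = segment (node D R) (suc s) m

  c≥1 : 1 ≤ c
  c≥1 = proj₁ (proj₂ arith) root

  interior-admissible : All (Admissible c) interior
  interior-admissible = All-segment (node D R) (suc s) m (λ k → proj₁ arith (vertex k) , proj₂ (argmin r) (vertex k))

  interior-balanced : Balanced c interior c
  interior-balanced = subst (λ x → Balanced x interior c) R-root
    (subst (Balanced (R s) interior) (trans (wrap r) R-root) (Balanced-segment D R s m (λ j _ → balance (s ℕ.+ j))))

  root-balance : D s ℕ.* c ≡ firstLabel interior c ℕ.+ lastLabel c interior
  root-balance = begin
    D s ℕ.* c                          ≡⟨ cong₂ ℕ._*_ (sym (wrap d)) (sym (trans (wrap r) R-root)) ⟩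
    D s⁺ ℕ.* R s⁺                      ≡⟨ balance s⁻ ⟩
    R s⁻ ℕ.+ R (suc s⁺)                ≡⟨ ℕ.+-comm (R s⁻) _ ⟩
    R (suc s⁺) ℕ.+ R s⁻                ≡⟨ cong₂ ℕ._+_ (wrap₁ r) last ⟩
    R (suc s) ℕ.+ lastLabel c interior ∎
    where
    open ≡-Reasoning
    last : R s⁻ ≡ lastLabel c interior
    last = sym (trans (cong (λ z → lastLabel z interior) (sym R-root)) (lastLabel-segment D R s m))

  facts : CycleFacts m c (D s) interior
  facts = cycleFacts m c (D s) interior (length-segment (node D R) (suc s) m) c≥1
            interior-admissible interior-balanced root-balance

  c∣r : ∀ i → c ∣ r i
  c∣r i with vertex-split s i
  ... | inj₁ refl               = ℕ.∣-reflexive (sym R-root)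
  ... | inj₂ (j , j<m , refl)   = All-segment⁻ (node D R) (suc s) m (proj₁ facts) j j<m

  c≡1 : c ≡ 1
  c≡1 = ℕ.∣1⇒≡1 (subst (c ∣_) (proj₁ (proj₂ (proj₂ arith))) (gcdAll-greatest r c c∣r))

  R-root≡1 : R s ≡ 1
  R-root≡1 = trans R-root c≡1

  r1≡1+count : r1 r ≡ suc (count c interior)
  r1≡1+count = begin
    r1 r                                                       ≡⟨ sumℕ-window (λ i → if r i ℕ.≡ᵇ 1 then 1 else 0) s ⟩
    (if R s ℕ.≡ᵇ 1 then 1 else 0) ℕ.+ window (λ k → if R k ℕ.≡ᵇ 1 then 1 else 0) (suc s) m
      ≡⟨ cong₂ ℕ._+_ (cong (λ z → if z ℕ.≡ᵇ 1 then 1 else 0) R-root≡1) (sym (count-segment 1 (node D R) (suc s) m)) ⟩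
    1 ℕ.+ count 1 interior                                     ≡⟨ cong (λ z → 1 ℕ.+ count z interior) (sym c≡1) ⟩
    suc (count c interior)                                     ∎
    where open ≡-Reasoning

  sumℕd≡ : sumℕ d ≡ D s ℕ.+ degSum interior
  sumℕd≡ = trans (sumℕ-window d s) (cong (D s ℕ.+_) (sym (degSum-segment (node D R) (suc s) m)))

  r1-formula : + r1 r ≡ + (3 ℕ.* n) - + sumℕ d
  r1-formula = begin
    + r1 r                              ≡⟨ sym (cancel (+ r1 r) (+ sumℕ d)) ⟩
    + r1 r + + sumℕ d - + sumℕ d      ≡⟨ cong (λ z → z - + sumℕ d) (sym (ℤ.pos-+ (r1 r) (sumℕ d))) ⟩
    + (r1 r ℕ.+ sumℕ d) - + sumℕ d      ≡⟨ cong (λ z → + z - + sumℕ d) total ⟩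
    + (3 ℕ.* n) - + sumℕ d                ∎
    where
    open ≡-Reasoning
    cancel : ∀ a b → a + b - b ≡ a
    cancel = solve-∀
    regroup : ∀ k d₀ t → suc k ℕ.+ (d₀ ℕ.+ t) ≡ k ℕ.+ 1 ℕ.+ d₀ ℕ.+ t
    regroup k d₀ t = trans (cong suc (sym (ℕ.+-assoc k d₀ t))) (cong (λ z → z ℕ.+ d₀ ℕ.+ t) (ℕ.+-comm 1 k))
    total : r1 r ℕ.+ sumℕ d ≡ 3 ℕ.* n
    total = trans (cong₂ ℕ._+_ r1≡1+count sumℕd≡)
              (trans (regroup (count c interior) (D s) (degSum interior)) (proj₁ (proj₂ facts)))

  order cofactor : ℤ
  order    = proj₂ (run D unforced s m (+ 0 , + 1))
  cofactor = proj₂ (run D unforced s m (+ 1 , + 0))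

  order≡r1 : order ≡ + r1 r
  order≡r1 = trans (cong proj₂ (run-continue D R s m (+ 0 , + 1)))
               (trans (proj₂ (proj₂ facts)) (cong +_ (sym r1≡1+count)))

  -- z s⁺ for the solution of (diag d − A) z = X on the interior with z s = z (s+1) = 0.
  defect : (ℕ → ℤ) → ℤ
  defect X = proj₂ (run D X s m (+ 0 , + 0))

  weight : (ℕ → ℤ) → ℤ
  weight X = + R s⁺ * X s⁺ + sumFrom (λ k → + R k * X k) s m

  solves-image : ∀ y z → (∀ i → y i ≡ lap n d z i) → Solves D (cyclic z) (cyclic y) s m
  solves-image y z y≡Lz j _ = trans (y≡Lz (vertex (suc (s ℕ.+ j)))) (lap-at d z (s ℕ.+ j))

  r-solves : Solves D (λ k → + R k) unforced s m
  r-solves j _ = balance₀ (s ℕ.+ j)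

  -- rᵀ (diag d − A) = 0, by Green's identity on the interior and the equation at the root.
  weight-image : ∀ y → InImage n d y → weight (cyclic y) ≡ + 0
  weight-image y (z , y≡Lz) = begin
    + R s⁺ * cyclic y s⁺ + sumFrom (λ k → + R k * cyclic y k) s m
      ≡⟨ cong₂ _+_ (cong (+ R s⁺ *_) (trans (y≡Lz (vertex s⁺)) (lap-at d z s⁻)))
                     (green-identity D R Z (cyclic y) s m r-solves (solves-image y z y≡Lz)) ⟩
    + R s⁺ * (+ D s⁺ * Z s⁺ - (Z (suc s⁺) + Z s⁻)) + (wronskian R Z s⁻ - wronskian R Z s)
      ≡⟨ cong (λ w → + R s⁺ * (+ D s⁺ * Z s⁺ - (Z (suc s⁺) + Z s⁻)) + (wronskian R Z s⁻ - w)) W-root ⟩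
    + R s⁺ * (+ D s⁺ * Z s⁺ - (Z (suc s⁺) + Z s⁻)) +
      ((+ R s⁺ * Z s⁻ - + R s⁻ * Z s⁺) - (+ R (suc s⁺) * Z s⁺ - + R s⁺ * Z (suc s⁺)))
      ≡⟨ collect (+ R s⁺) (Z s⁺) (Z (suc s⁺)) (Z s⁻) (+ R s⁻) (+ R (suc s⁺)) (+ D s⁺) ⟩
    Z s⁺ * (+ D s⁺ * + R s⁺ - (+ R s⁻ + + R (suc s⁺)))
      ≡⟨ cong (λ w → Z s⁺ * w) (ℤ.i≡j⇒i-j≡0 root-balanceℤ) ⟩
    Z s⁺ * + 0
      ≡⟨ ℤ.*-zeroʳ (Z s⁺) ⟩
    + 0 ∎
    where
    open ≡-Reasoning
    Z : ℕ → ℤ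
    Z = cyclic z
    W-root : wronskian R Z s ≡ + R (suc s⁺) * Z s⁺ - + R s⁺ * Z (suc s⁺)
    W-root = cong₂ _-_ (cong₂ _*_ (cong +_ (sym (wrap₁ r))) (sym (wrap z)))
                       (cong₂ _*_ (cong +_ (sym (wrap r))) (sym (wrap₁ z)))
    root-balanceℤ : + D s⁺ * + R s⁺ ≡ + R s⁻ + + R (suc s⁺)
    root-balanceℤ = trans (sym (ℤ.pos-* (D s⁺) (R s⁺)))
                      (trans (cong +_ (balance s⁻)) (ℤ.pos-+ (R s⁻) (R (suc s⁺))))
    collect : ∀ ρ ζ z⁺ z⁻ R⁻ R⁺ d → ρ * (d * ζ - (z⁺ + z⁻)) + ((ρ * z⁻ - R⁻ * ζ) - (R⁺ * ζ - ρ * z⁺))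
              ≡ ζ * (d * ρ - (R⁻ + R⁺))
    collect = solve-∀

  run-closes : ∀ Z X → Solves D Z X s m → Z s⁺ ≡ Z s * cofactor + Z (suc s) * order + defect X
  run-closes Z X sol =
    trans (sym (cong proj₂ (run-solution D Z X s m sol))) (cong proj₂ (run-affine D X s m (Z s) (Z (suc s))))

  eliminate-cofactor : ∀ a p q x y ρ → x ≡ x * a + y * p + q → + 1 ≡ + 1 * a + ρ * p + + 0 →
    q ≡ (x * ρ - y) * p
  eliminate-cofactor a p q x y ρ x≡ 1≡ = begin
    q                                                                              ≡⟨ expand a p q x y ρ ⟩
    (x * a + y * p + q) - x * (+ 1 * a + ρ * p + + 0) - y * p + x * ρ * p
      ≡⟨ cong₂ (λ u v → u - x * v - y * p + x * ρ * p) (sym x≡) (sym 1≡) ⟩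
    x - x * + 1 - y * p + x * ρ * p                                     ≡⟨ factor x y p ρ ⟩
    (x * ρ - y) * p                                                            ∎
    where
    open ≡-Reasoning
    expand : ∀ a p q x y ρ →
      q ≡ (x * a + y * p + q) - x * (+ 1 * a + ρ * p + + 0) - y * p + x * ρ * p
    expand = solve-∀
    factor : ∀ x y p ρ → x - x * + 1 - y * p + x * ρ * p ≡ (x * ρ - y) * p
    factor = solve-∀

  r-closes : + 1 ≡ + 1 * cofactor + + R (suc s) * order + + 0
  r-closes = begin
    + 1                                                          ≡⟨ cong +_ (sym (trans (wrap r) R-root≡1)) ⟩
    + R s⁺                                                       ≡⟨ run-closes (λ k → + R k) unforced r-solves ⟩
    + R s * cofactor + + R (suc s) * order + defect unforced
      ≡⟨ cong₂ (λ a b → a * cofactor + + R (suc s) * order + b) (cong +_ R-root≡1)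
                 (cong proj₂ (run-zero D unforced s m (λ _ _ → refl))) ⟩
    + 1 * cofactor + + R (suc s) * order + + 0          ∎
    where open ≡-Reasoning

  defect-image : ∀ y → InImage n d y → ∃ λ t → defect (cyclic y) ≡ t * order
  defect-image y (z , y≡Lz) = cyclic z s * + R (suc s) - cyclic z (suc s) ,
    eliminate-cofactor cofactor order (defect (cyclic y)) (cyclic z s) (cyclic z (suc s)) (+ R (suc s))
      (trans (sym (wrap z)) (run-closes (cyclic z) (cyclic y) (solves-image y z y≡Lz))) r-closes

  module Preimage (x : Fin n → ℤ) (weight≡0 : weight (cyclic x) ≡ + 0)
                  (t : ℤ) (defect≡ : defect (cyclic x) ≡ t * order) where

    X : ℕ → ℤ
    X = cyclic x

    walk : ℕ → ℤ
    walk j = proj₁ (run D X s j (+ 0 , - t))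

    z : Fin n → ℤ
    z = fromWalk s walk

    Z : ℕ → ℤ
    Z = cyclic z

    walk-closes : walk n ≡ + 0
    walk-closes = begin
      proj₂ (run D X s m (+ 0 , - t))                                     ≡⟨ cong proj₂ (run-affine D X s m (+ 0) (- t)) ⟩
      + 0 * cofactor + - t * order + defect X                     ≡⟨ cong (λ w → + 0 * cofactor + - t * order + w) defect≡ ⟩
      + 0 * cofactor + - t * order + t * order                  ≡⟨ cancel cofactor order t ⟩
      + 0                                                                   ∎
      where
      open ≡-Reasoning
      cancel : ∀ a p t → + 0 * a + - t * p + t * p ≡ + 0
      cancel = solve-∀

    Z≡walk : ∀ j → j ≤ n → Z (s ℕ.+ j) ≡ walk j
    Z≡walk j j≤n with ℕ.m≤n⇒m<n∨m≡n j≤n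
    ... | inj₁ j<n  = cyclic-fromWalk s walk j j<n
    ... | inj₂ refl = trans (cyclic-periodic z s) (trans (cong Z (sym (ℕ.+-identityʳ s)))
                        (trans (cyclic-fromWalk s walk 0 (s≤s z≤n)) (sym walk-closes)))

    Z-root : Z s ≡ + 0
    Z-root = trans (cong Z (sym (ℕ.+-identityʳ s))) (Z≡walk 0 z≤n)

    walk-step : ∀ j → X (suc (s ℕ.+ j)) ≡ + D (suc (s ℕ.+ j)) * walk (suc j) - (walk (suc (suc j)) + walk j)
    walk-step j = unfold (+ D (suc (s ℕ.+ j))) (walk j) (walk (suc j)) (X (suc (s ℕ.+ j)))
      where
      unfold : ∀ d w₀ w₁ x → x ≡ d * w₁ - ((d * w₁ - w₀ - x) + w₀)
      unfold = solve-∀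

    solves : Solves D Z X s m
    solves j j<m = begin
      X (suc (s ℕ.+ j))                                                        ≡⟨ walk-step j ⟩
      + D (suc (s ℕ.+ j)) * walk (suc j) - (walk (suc (suc j)) + walk j)
        ≡⟨ cong₂ (λ a b → + D (suc (s ℕ.+ j)) * a - b) (sym Z₁) (sym (cong₂ _+_ Z₂ Z₀)) ⟩
      + D (suc (s ℕ.+ j)) * Z (suc (s ℕ.+ j)) - (Z (suc (suc (s ℕ.+ j))) + Z (s ℕ.+ j)) ∎
      where
      open ≡-Reasoning
      Z₀ : Z (s ℕ.+ j) ≡ walk j
      Z₀ = Z≡walk j (ℕ.≤-trans (ℕ.<⇒≤ j<m) (ℕ.n≤1+n m))
      Z₁ : Z (suc (s ℕ.+ j)) ≡ walk (suc j)
      Z₁ = trans (cong Z (sym (ℕ.+-suc s j))) (Z≡walk (suc j) (ℕ.≤-trans j<m (ℕ.n≤1+n m)))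
      Z₂ : Z (suc (suc (s ℕ.+ j))) ≡ walk (suc (suc j))
      Z₂ = trans (cong Z (cong suc (sym (ℕ.+-suc s j)))) (trans (cong Z (sym (ℕ.+-suc s (suc j)))) (Z≡walk (suc (suc j)) (s≤s j<m)))

    Z-root⁺ : Z s⁺ ≡ + 0
    Z-root⁺ = trans (wrap z) Z-root

    -- The weight condition is exactly the missing equation at the root.
    weight-at-root : + 1 * X s⁺ + ((+ 1 * Z s⁻ - + R s⁻ * + 0)
                                      - (+ R (suc s⁺) * + 0 - + 1 * Z (suc s⁺))) ≡ + 0
    weight-at-root = trans (sym (cong₂ _+_ (cong (_* X s⁺) R⁺≡1) (trans (green-identity D R Z X s m r-solves solves) W-ends))) weight≡0
      where
      R⁺≡1 : + R s⁺ ≡ + 1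
      R⁺≡1 = cong +_ (trans (wrap r) R-root≡1)
      W-ends : wronskian R Z s⁻ - wronskian R Z s ≡
        (+ 1 * Z s⁻ - + R s⁻ * + 0) - (+ R (suc s⁺) * + 0 - + 1 * Z (suc s⁺))
      W-ends = cong₂ _-_ (cong₂ _-_ (cong (_* Z s⁻) R⁺≡1) (cong (+ R s⁻ *_) Z-root⁺))
                         (cong₂ _-_ (cong₂ _*_ (cong +_ (sym (wrap₁ r))) Z-root)
                                    (cong₂ _*_ (cong +_ R-root≡1) (sym (wrap₁ z))))

    solves-root : X s⁺ ≡ + D s⁺ * Z s⁺ - (Z (suc s⁺) + Z s⁻)
    solves-root = begin
      X s⁺                                   ≡⟨ isolate (X s⁺) (Z s⁻) (Z (suc s⁺)) (+ R s⁻) (+ R (suc s⁺)) (+ D s⁺) ⟩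
      weight′ + (+ D s⁺ * + 0 - neighbours)  ≡⟨ cong (_+ (+ D s⁺ * + 0 - neighbours)) weight-at-root ⟩
      + 0 + (+ D s⁺ * + 0 - neighbours)      ≡⟨ ℤ.+-identityˡ _ ⟩
      + D s⁺ * + 0 - neighbours              ≡⟨ cong (λ w → + D s⁺ * w - neighbours) (sym Z-root⁺) ⟩
      + D s⁺ * Z s⁺ - neighbours             ∎
      where
      open ≡-Reasoning
      neighbours weight′ : ℤ
      neighbours = Z (suc s⁺) + Z s⁻
      weight′ = + 1 * X s⁺ + ((+ 1 * Z s⁻ - + R s⁻ * + 0) - (+ R (suc s⁺) * + 0 - + 1 * Z (suc s⁺)))
      isolate : ∀ x a b ρ⁻ ρ⁺ d → x ≡ (+ 1 * x + ((+ 1 * a - ρ⁻ * + 0) - (ρ⁺ * + 0 - + 1 * b)))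
                                        + (d * + 0 - (b + a))
      isolate = solve-∀

    preimage : InImage n d x
    preimage = z , λ i → at i (vertex-split s i)
      where
      at : ∀ i → i ≡ vertex s ⊎ ∃ (λ j → j < m × i ≡ vertex (suc (s ℕ.+ j))) → x i ≡ lap n d z i
      at i (inj₂ (j , j<m , refl)) = trans (solves j j<m) (sym (lap-at d z (s ℕ.+ j)))
      at i (inj₁ refl) = subst (λ w → x w ≡ lap n d z w) (wrap (λ i → i)) (trans solves-root (sym (lap-at d z s⁻)))

  weight-* : ∀ X k → weight (λ q → k * X q) ≡ k * weight X
  weight-* X k = trans (cong (λ w → + R s⁺ * (k * X s⁺) + w) (sumFrom-* (λ q → + R q) X k s m))
                   (distrib (+ R s⁺) (X s⁺) (sumFrom (λ q → + R q * X q) s m) k)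
    where
    distrib : ∀ ρ x σ k → ρ * (k * x) + k * σ ≡ k * (ρ * x + σ)
    distrib = solve-∀

  weight-torsion : ∀ x → IsTorsion n d x → weight (cyclic x) ≡ + 0
  weight-torsion x (suc k , _ , kx∈im) = fromInj₂ (λ ()) (ℤ.i*j≡0⇒i≡0∨j≡0 (+ suc k)
    (trans (sym (weight-* (cyclic x) (+ suc k))) (weight-image (λ i → + suc k * x i) kx∈im)))

  defect-+ : ∀ X Y → defect (λ q → X q + Y q) ≡ defect X + defect Y
  defect-+ X Y = cong proj₂ (run-+ D X Y s m (+ 0) (+ 0) (+ 0) (+ 0))

  defect-* : ∀ X k → defect (λ q → k * X q) ≡ k * defect X
  defect-* X k = trans (cong (λ w → proj₂ (run D (λ q → k * X q) s m (w , w))) (sym (ℤ.*-zeroʳ k)))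
                   (cong proj₂ (run-* D X s m k (+ 0) (+ 0)))

  defect-neg : ∀ X → defect (λ q → - X q) ≡ - defect X
  defect-neg X = trans (cong proj₂ (run-cong D (λ q → - X q) (λ q → ℤ.-1ℤ * X q) s m (+ 0 , + 0) (λ q → sym (ℤ.-1*i≡-i (X q)))))
                   (trans (defect-* X ℤ.-1ℤ) (ℤ.-1*i≡-i (defect X)))

  ψ : (x : Vecℤ n) → IsTorsion n d x → ℤ
  ψ x _ = defect (cyclic x)

  ψ-well-defined : ∀ x y (tx : IsTorsion n d x) (ty : IsTorsion n d y) →
    InImage n d (λ i → x i - y i) → ψ x tx ≡[mod r1 r ] ψ y ty
  ψ-well-defined x y _ _ x-y∈im = ∣⇒∣ᵤ (divides t (begin
    defect (cyclic x) - defect (cyclic y)                  ≡⟨ cong (λ w → defect (cyclic x) + w) (sym (defect-neg (cyclic y))) ⟩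
    defect (cyclic x) + defect (λ q → - cyclic y q)    ≡⟨ sym (defect-+ (cyclic x) (λ q → - cyclic y q)) ⟩
    defect (cyclic (λ i → x i - y i))                      ≡⟨ proj₂ multiple ⟩
    t * order                                            ≡⟨ cong (t *_) order≡r1 ⟩
    t * + r1 r                                           ∎))
    where
    open ≡-Reasoning
    multiple : ∃ λ t → defect (cyclic (λ i → x i - y i)) ≡ t * order
    multiple = defect-image (λ i → x i - y i) x-y∈im
    t : ℤ
    t = proj₁ multiple

  ψ-homomorphism : ∀ x y (tx : IsTorsion n d x) (ty : IsTorsion n d y) (txy : IsTorsion n d (λ i → x i + y i)) →
    ψ (λ i → x i + y i) txy ≡[mod r1 r ] (ψ x tx + ψ y ty)
  ψ-homomorphism x y _ _ _ = subst (+ r1 r ∣ℤ_) (sym (ℤ.i≡j⇒i-j≡0 (defect-+ (cyclic x) (cyclic y)))) (r1 r ℕ.∣0)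

  ψ-injective : ∀ x (tx : IsTorsion n d x) → ψ x tx ≡[mod r1 r ] (+ 0) → InImage n d x
  ψ-injective x tx r1∣ψx = Preimage.preimage x (weight-torsion x tx) (quotient r1∣ψx′)
    (trans (sym (ℤ.+-identityʳ (defect (cyclic x)))) (trans (Signed._∣_.equality r1∣ψx′) (cong (quotient r1∣ψx′ *_) (sym order≡r1))))
    where
    r1∣ψx′ : + r1 r Signed.∣ defect (cyclic x) - + 0
    r1∣ψx′ = ∣ᵤ⇒∣ r1∣ψx

  ψ-surjective : ∀ (a : ℤ) → ∃[ x ] Σ (IsTorsion n d x) λ tx → ψ x tx ≡[mod r1 r ] a
  ψ-surjective a = x , x-torsion , subst (+ r1 r ∣ℤ_) (sym (ℤ.i≡j⇒i-j≡0 defect≡a)) (r1 r ℕ.∣0)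
    where
    g : ℕ → ℤ
    g zero    = a * + R s⁻
    g (suc j) = if suc j ℕ.≡ᵇ m then - a else + 0
    x : Fin n → ℤ
    x = fromWalk s g
    x-interior : ∀ j → j < m → cyclic x (suc (s ℕ.+ j)) ≡ g (suc j)
    x-interior j j<m = trans (cong (cyclic x) (sym (ℕ.+-suc s j))) (cyclic-fromWalk s g (suc j) (s≤s j<m))
    x-zero : ∀ j → j < m′ → cyclic x (suc (s ℕ.+ j)) ≡ + 0
    x-zero j j<m′ = trans (x-interior j (ℕ.m<n⇒m<1+n j<m′))
                      (cong (λ b → if b then - a else + 0) (dec-false (j ℕ.≟ m′) (ℕ.<⇒≢ j<m′)))
    x-last : cyclic x (suc (s ℕ.+ m′)) ≡ - a
    x-last = trans (x-interior m′ ℕ.≤-refl) (cong (λ b → if b then - a else + 0) (≡ᵇ-refl m′))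
    defect≡a : defect (cyclic x) ≡ a
    defect≡a = begin
      proj₂ (step D (cyclic x) (suc (s ℕ.+ m′)) (run D (cyclic x) s m′ (+ 0 , + 0)))
        ≡⟨ cong (λ w → proj₂ (step D (cyclic x) (suc (s ℕ.+ m′)) w)) (run-zero D (cyclic x) s m′ x-zero) ⟩
      + D (suc (s ℕ.+ m′)) * + 0 - + 0 - cyclic x (suc (s ℕ.+ m′))
        ≡⟨ cong (λ w → + D (suc (s ℕ.+ m′)) * + 0 - + 0 - w) x-last ⟩
      + D (suc (s ℕ.+ m′)) * + 0 - + 0 - - a
        ≡⟨ cancel (+ D (suc (s ℕ.+ m′))) a ⟩
      a ∎
      where
      open ≡-Reasoning
      cancel : ∀ D a → D * + 0 - + 0 - - a ≡ a
      cancel = solve-∀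
    weight≡0 : weight (cyclic x) ≡ + 0
    weight≡0 = trans (cong₂ _+_ (cong₂ _*_ (cong +_ (trans (wrap r) R-root≡1)) x-root)
                        (cong₂ _+_ (sumFrom-zero (λ k → + R k * cyclic x k) s m′
                                       (λ j j<m′ → trans (cong (+ R (suc (s ℕ.+ j)) *_) (x-zero j j<m′)) (ℤ.*-zeroʳ (+ R (suc (s ℕ.+ j))))))
                                     (cong₂ _*_ (cong (λ w → + R w) (sym (ℕ.+-suc s m′))) x-last)))
                 (cancel a (+ R s⁻))
      where
      x-root : cyclic x s⁺ ≡ g 0
      x-root = trans (wrap x) (trans (cong (cyclic x) (sym (ℕ.+-identityʳ s))) (cyclic-fromWalk s g 0 (s≤s z≤n)))
      cancel : ∀ a ρ → + 1 * (a * ρ) + (+ 0 + ρ * - a) ≡ + 0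
      cancel = solve-∀
    x-torsion : IsTorsion n d x
    x-torsion = r1 r , subst (1 ≤_) (sym r1≡1+count) (s≤s z≤n) ,
      Preimage.preimage (λ i → + r1 r * x i)
        (trans (weight-* (cyclic x) (+ r1 r)) (trans (cong (+ r1 r *_) weight≡0) (ℤ.*-zeroʳ (+ r1 r)))) a
        (trans (defect-* (cyclic x) (+ r1 r)) (trans (cong (+ r1 r *_) defect≡a)
          (trans (ℤ.*-comm (+ r1 r) a) (cong (a *_) (sym order≡r1)))))

  critical-group : CritGroupIsoZmod n d (r1 r)
  critical-group = ψ , ψ-well-defined , ψ-homomorphism , ψ-injective , ψ-surjective

open import Data.Nat using (_≤_; _*_; s≤s; z≤n)
open import Data.Integer using (+_; _-_)
open import Data.Product using (_×_; _,_)
open import Relation.Binary.PropositionalEquality using (_≡_)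

theorem3p6 : (n : ℕ) → 2 ≤ n → (d r : Fin n → ℕ) → IsArithStructure n d r →
    (+ r1 r ≡ + (3 * n) - + sumℕ d) × CritGroupIsoZmod n d (r1 r)
theorem3p6 (ℕ.suc (ℕ.suc m′)) (s≤s (s≤s z≤n)) d r arith = r1-formula , critical-group
  where open ArithmeticalStructureOnCycle m′ d r arith
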